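{- Let $i,j,k$ be nonnegative integers and $N\ge1$ an integer. Then \[ \pi_N\bigl(\operatorname{Supp}(C^{Nk}_{Ni,Nj})\bigr)=\operatorname{Supp}\bigl((C^k_{i,j})^N\bigr). \]
   Context: For the equivariant cohomology of projective space $\mathbb{P}^n$ under the diagonal torus, with $H_T^*(\mathrm{pt})=\mathbb{Z}[t_1,\dots,t_{n+1}]$, let $\sigma_k=\prod_{m=1}^k(\zeta+t_m)$ ($\zeta=c_1^T(\mathcal{O}(1))$) be the class of the codimension-$k$ coordinate subspace $\{x_0=\dots=x_{k-1}=0\}$, and define $C^k_{i,j}$ by $\sigma_i\sigma_j=\sum_kC^k_{i,j}\sigma_k$. These constants, written as polynomials in $\beta_m=t_m-t_{m+1}$, do not depend on $n$ once $n$ is large, and one works in $H_T^*(\mathbb{P}^\infty)$, regarding $C^k_{i,j}$ as elements of $\mathbb{Z}[\beta_1,\beta_2,\dots]$. The support $\operatorname{Supp}$ of such a polynomial is the set of exponent vectors (finitely supported vectors in $\mathbb{Z}_{\ge0}^\infty\subset\mathbb{R}^\infty$) of its monomials with nonzero coefficient. The linear map $\pi_N:\mathbb{R}^\infty\to\mathbb{R}^\infty$ is $\pi_N(x_1,x_2,\dots)=\bigl(\sum_{m=1}^Nx_m,\ \sum_{m=N+1}^{2N}x_m,\ \sum_{m=2N+1}^{3N}x_m,\dots\bigr)$. -}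

module Defs where

open import Data.Nat as ℕ using (ℕ; zero; suc; _≡ᵇ_; _<ᵇ_)
open import Data.Integer as ℤ using (ℤ; 0ℤ; 1ℤ)
open import Data.List using (List; []; _∷_; _++_; map; foldr; concatMap; take)
open import Data.Bool using (Bool; true; false; _∧_; if_then_else_)
open import Data.Product using (_×_; _,_)

-- Exponent vectors (monomials in β₁, β₂, …): finitely supported vectors
-- of naturals, represented as lists (entry at index m is the exponent of
-- β_{m+1}); trailing zeros are irrelevant.

Mono : Set
Mono = List ℕ

get : Mono → ℕ → ℕ
get []       _       = 0
get (x ∷ _)  zero    = x
get (_ ∷ xs) (suc m) = get xs m

eqMono : Mono → Mono → Bool
eqMono []       []       = true
eqMono []       (y ∷ ys) = (y ≡ᵇ 0) ∧ eqMono [] ys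
eqMono (x ∷ xs) []       = (x ≡ᵇ 0) ∧ eqMono xs []
eqMono (x ∷ xs) (y ∷ ys) = (x ≡ᵇ y) ∧ eqMono xs ys

addMono : Mono → Mono → Mono
addMono []       ys       = ys
addMono xs       []       = xs
addMono (x ∷ xs) (y ∷ ys) = (x ℕ.+ y) ∷ addMono xs ys

-- Polynomials in ℤ[β₁, β₂, …], as formal sums of terms (coefficient,
-- monomial); no normalisation, the polynomial is determined by `coeff`.

Poly : Set
Poly = List (ℤ × Mono)

coeff : Poly → Mono → ℤ
coeff []             e = 0ℤ
coeff ((c , m) ∷ p)  e = if eqMono m e then c ℤ.+ coeff p e else coeff p e

pzero pone : Poly
pzero = []
pone  = (1ℤ , []) ∷ []

padd : Poly → Poly → Poly
padd = _++_

pneg : Poly → Poly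
pneg = map (λ { (c , m) → (ℤ.- c , m) })

pmul : Poly → Poly → Poly
pmul p q = concatMap (λ { (c , m) → map (λ { (d , n) → (c ℤ.* d , addMono m n) }) q }) p

ppow : Poly → ℕ → Poly
ppow p zero    = pone
ppow p (suc n) = pmul p (ppow p n)

beta : ℕ → Poly
beta l = (1ℤ , unit l) ∷ []
  where
  unit : ℕ → Mono
  unit zero          = []          -- unused (l ≥ 1)
  unit (suc zero)    = 1 ∷ []
  unit (suc (suc l)) = 0 ∷ unit (suc l)

-- b_m = β₁ + … + β_{m-1} = t₁ - t_m
bsum : ℕ → Poly
bsum zero          = pzero
bsum (suc zero)    = pzero
bsum (suc (suc m)) = padd (bsum (suc m)) (beta (suc m))

-- Polynomials in u = ζ + t₁ over ℤ[β] (list of coefficients, low degree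
-- first).  Then ζ + t_m = u - b_m.

UPoly : Set
UPoly = List Poly

uadd : UPoly → UPoly → UPoly
uadd []       g        = g
uadd f        []       = f
uadd (a ∷ f)  (b ∷ g)  = padd a b ∷ uadd f g

uscale : Poly → UPoly → UPoly
uscale c = map (pmul c)

umul : UPoly → UPoly → UPoly
umul []      g = []
umul (a ∷ f) g = uadd (uscale a g) (pzero ∷ umul f g)

-- σ_k = ∏_{m=1}^{k} (ζ + t_m) = ∏_{m=1}^{k} (u - b_m)
sigma : ℕ → UPoly
sigma zero    = pone ∷ []
sigma (suc k) = umul (sigma k) (pneg (bsum (suc k)) ∷ pone ∷ [])

nthP : UPoly → ℕ → Poly
nthP []      _       = pzero
nthP (a ∷ _) zero    = a
nthP (_ ∷ f) (suc n) = nthP f n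

-- Expansion of a polynomial f of u-degree ≤ d in the (monic) basis σ_0, σ_1, …:
-- expand d f k = coefficient of σ_k.
expand : ℕ → UPoly → ℕ → Poly
expand zero    f k = if k ≡ᵇ 0 then nthP f 0 else pzero
expand (suc d) f k =
  if k ≡ᵇ suc d then lead
  else if k <ᵇ suc d then expand d (take (suc d) (uadd f (uscale (pneg lead) (sigma (suc d))))) k
  else pzero
  where
  lead : Poly
  lead = nthP f (suc d)

-- Structure constants:  σ_i σ_j = Σ_k C k i j · σ_k   (C k i j = C^k_{i,j})
C : ℕ → ℕ → ℕ → Poly
C k i j = expand (i ℕ.+ j) (umul (sigma i) (sigma j)) k

_∈Supp_ : Mono → Poly → Set
e ∈Supp p = ¬' (coeff p e ≡' 0ℤ)
  where
  open import Relation.Nullary renaming (¬_ to ¬')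
  open import Relation.Binary.PropositionalEquality renaming (_≡_ to _≡'_)

sumBelow : ℕ → (ℕ → ℕ) → ℕ
sumBelow zero    f = 0
sumBelow (suc n) f = sumBelow n f ℕ.+ f n

-- π_N x equals y (as exponent vectors): for every m ≥ 0 (0-based block index),
--   Σ_{l<N} x_{mN + l} = y_m
πN[_]_≡_ : ℕ → Mono → Mono → Set
πN[ N ] x ≡ y = ∀ m → sumBelow N (λ l → get x (m ℕ.* N ℕ.+ l)) ≡' get y m
  where open import Relation.Binary.PropositionalEquality renaming (_≡_ to _≡'_)

-- Write u = ζ + t₁, so that σ_k = (u - b_1)⋯(u - b_k) with b_m = β_1 + ⋯ + β_{m-1}.  Multiplying σ_j
-- by the factors of σ_i one at a time and using σ_p (u - b_{l+1}) = σ_{p+1} + (β_{l+1} + ⋯ + β_p) σ_p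
-- shows that for i ≤ j the polynomial C^k_{i,j} has only positive coefficients, and that (when
-- j ≤ k ≤ i + j) its exponent vectors are exactly the lattice points of the polytope P of the x ≥ 0
-- supported below k with Σ_l x_l = i + j - k and Σ_{l<t} x_l ≤ t for all t.  Hence Supp((C^k_{i,j})^N)
-- is the set of N-fold sums of lattice points of P, which is the set of lattice points of N·P by the
-- integer decomposition property of P: peel off the point whose prefix sums are the rounded-up N-th
-- parts of the given ones.  On the other side, π_N maps the lattice points of the polytope for
-- (Ni, Nj, Nk) onto those of N·P: block sums preserve the constraints, and placing each entry at the
-- end of a block of length N gives a preimage.

module Submission where

open import Defs

module Monomials where

  open import Data.Bool using (Bool; true; T; _∧_)
  open import Data.Bool.Properties using (T-∧; T-≡; ⇔→≡)
  open import Data.Empty using (⊥-elim)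
  open import Data.List using ([]; _∷_; applyUpTo)
  open import Data.Nat using (ℕ; zero; suc; _+_; _∸_; _≤_; _<_; _≤ᵇ_; _≡ᵇ_; z≤n; s≤s; _≟_)
  open import Data.Nat.Properties
  open import Data.Product using (_,_; proj₁; proj₂)
  open import Function using (_∘_)
  open import Function.Bundles using (Equivalence; mk⇔)
  open import Level using (0ℓ)
  open import Relation.Binary.Bundles using (Setoid)
  open import Relation.Binary.Core using (_Preserves₂_⟶_⟶_)
  open import Relation.Binary.PropositionalEquality
  open import Relation.Nullary using (yes; no)
  open Equivalence using (to; from)

  infix 4 _≋_

  record _≋_ (a b : Mono) : Set where
    constructor mk≋
    field get-≡ : ∀ i → get a i ≡ get b i

  open _≋_ public

  ≋-refl : ∀ {a} → a ≋ a
  ≋-refl = mk≋ λ _ → refl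

  ≋-sym : ∀ {a b} → a ≋ b → b ≋ a
  ≋-sym a≋b = mk≋ λ i → sym (get-≡ a≋b i)

  ≋-trans : ∀ {a b c} → a ≋ b → b ≋ c → a ≋ c
  ≋-trans a≋b b≋c = mk≋ λ i → trans (get-≡ a≋b i) (get-≡ b≋c i)

  ≋-setoid : Setoid 0ℓ 0ℓ
  ≋-setoid = record
    { Carrier       = Mono
    ; _≈_           = _≋_
    ; isEquivalence = record { refl = ≋-refl ; sym = ≋-sym ; trans = ≋-trans }
    }

  get-addMono : ∀ a b i → get (addMono a b) i ≡ get a i + get b i
  get-addMono []      b       i       = refl
  get-addMono (x ∷ a) []      i       = sym (+-identityʳ _)
  get-addMono (x ∷ a) (y ∷ b) zero    = refl
  get-addMono (x ∷ a) (y ∷ b) (suc i) = get-addMono a b i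

  addMono-identityʳ : ∀ a → addMono a [] ≡ a
  addMono-identityʳ []      = refl
  addMono-identityʳ (x ∷ a) = refl

  addMono-comm : ∀ a b → addMono a b ≡ addMono b a
  addMono-comm []      []      = refl
  addMono-comm []      (y ∷ b) = refl
  addMono-comm (x ∷ a) []      = refl
  addMono-comm (x ∷ a) (y ∷ b) = cong₂ _∷_ (+-comm x y) (addMono-comm a b)

  addMono-assoc : ∀ a b c → addMono (addMono a b) c ≡ addMono a (addMono b c)
  addMono-assoc []      b       c       = refl
  addMono-assoc (x ∷ a) []      c       = refl
  addMono-assoc (x ∷ a) (y ∷ b) []      = refl
  addMono-assoc (x ∷ a) (y ∷ b) (z ∷ c) = cong₂ _∷_ (+-assoc x y z) (addMono-assoc a b c)

  addMono-cong : addMono Preserves₂ _≋_ ⟶ _≋_ ⟶ _≋_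
  addMono-cong {a} {a′} {b} {b′} a≋a′ b≋b′ = mk≋ λ i → begin
    get (addMono a b) i     ≡⟨ get-addMono a b i ⟩
    get a i + get b i       ≡⟨ cong₂ _+_ (get-≡ a≋a′ i) (get-≡ b≋b′ i) ⟩
    get a′ i + get b′ i     ≡⟨ get-addMono a′ b′ i ⟨
    get (addMono a′ b′) i   ∎
    where open ≡-Reasoning

  eqMono⇒≋ : ∀ a b → T (eqMono a b) → a ≋ b
  eqMono⇒≋ a b t = mk≋ (pointwise a b t)
    where
    pointwise : ∀ a b → T (eqMono a b) → ∀ i → get a i ≡ get b i
    pointwise []      []      _ i       = refl
    pointwise []      (y ∷ b) t zero    = sym (≡ᵇ⇒≡ y 0 (proj₁ (to T-∧ t)))
    pointwise []      (y ∷ b) t (suc i) = pointwise [] b (proj₂ (to T-∧ t)) i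
    pointwise (x ∷ a) []      t zero    = ≡ᵇ⇒≡ x 0 (proj₁ (to T-∧ t))
    pointwise (x ∷ a) []      t (suc i) = pointwise a [] (proj₂ (to T-∧ t)) i
    pointwise (x ∷ a) (y ∷ b) t zero    = ≡ᵇ⇒≡ x y (proj₁ (to T-∧ t))
    pointwise (x ∷ a) (y ∷ b) t (suc i) = pointwise a b (proj₂ (to T-∧ t)) i

  ≋⇒eqMono : ∀ a b → a ≋ b → T (eqMono a b)
  ≋⇒eqMono []      []      _   = _
  ≋⇒eqMono []      (y ∷ b) a≋b =
    from T-∧ (≡⇒≡ᵇ y 0 (sym (get-≡ a≋b 0)) , ≋⇒eqMono [] b (mk≋ (get-≡ a≋b ∘ suc)))
  ≋⇒eqMono (x ∷ a) []      a≋b =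
    from T-∧ (≡⇒≡ᵇ x 0 (get-≡ a≋b 0) , ≋⇒eqMono a [] (mk≋ (get-≡ a≋b ∘ suc)))
  ≋⇒eqMono (x ∷ a) (y ∷ b) a≋b =
    from T-∧ (≡⇒≡ᵇ x y (get-≡ a≋b 0) , ≋⇒eqMono a b (mk≋ (get-≡ a≋b ∘ suc)))

  leMono : Mono → Mono → Bool
  leMono []      b       = true
  leMono (x ∷ a) []      = (x ≡ᵇ 0) ∧ leMono a []
  leMono (x ∷ a) (y ∷ b) = (x ≤ᵇ y) ∧ leMono a b

  subMono : Mono → Mono → Mono
  subMono a       []      = a
  subMono []      (y ∷ b) = []
  subMono (x ∷ a) (y ∷ b) = (x ∸ y) ∷ subMono a b

  get-subMono : ∀ a b i → get (subMono a b) i ≡ get a i ∸ get b i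
  get-subMono a       []      i       = refl
  get-subMono []      (y ∷ b) zero    = sym (0∸n≡0 y)
  get-subMono []      (y ∷ b) (suc i) = sym (0∸n≡0 (get b i))
  get-subMono (x ∷ a) (y ∷ b) zero    = refl
  get-subMono (x ∷ a) (y ∷ b) (suc i) = get-subMono a b i

  leMono⇒≤ : ∀ a b → T (leMono a b) → ∀ i → get a i ≤ get b i
  leMono⇒≤ []      b       _ i       = z≤n
  leMono⇒≤ (x ∷ a) []      t zero    = ≤-reflexive (≡ᵇ⇒≡ x 0 (proj₁ (to T-∧ t)))
  leMono⇒≤ (x ∷ a) []      t (suc i) = leMono⇒≤ a [] (proj₂ (to T-∧ t)) i
  leMono⇒≤ (x ∷ a) (y ∷ b) t zero    = ≤ᵇ⇒≤ x y (proj₁ (to T-∧ t))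
  leMono⇒≤ (x ∷ a) (y ∷ b) t (suc i) = leMono⇒≤ a b (proj₂ (to T-∧ t)) i

  ≤⇒leMono : ∀ a b → (∀ i → get a i ≤ get b i) → T (leMono a b)
  ≤⇒leMono []      b       _   = _
  ≤⇒leMono (x ∷ a) []      a≤b =
    from T-∧ (≡⇒≡ᵇ x 0 (n≤0⇒n≡0 (a≤b 0)) , ≤⇒leMono a [] (a≤b ∘ suc))
  ≤⇒leMono (x ∷ a) (y ∷ b) a≤b = from T-∧ (≤⇒≤ᵇ (a≤b 0) , ≤⇒leMono a b (a≤b ∘ suc))

  subMono-addMono : ∀ a b → (∀ i → get b i ≤ get a i) → addMono (subMono a b) b ≋ a
  subMono-addMono a b b≤a = mk≋ λ i →
    trans (get-addMono (subMono a b) b i) (trans (cong (_+ get b i) (get-subMono a b i)) (m∸n+n≡m (b≤a i)))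

  -- Stated as an equation of booleans so that it can be used with rewrite.
  eqMono-addMono : ∀ a b e → eqMono (addMono a b) e ≡ leMono a e ∧ eqMono b (subMono e a)
  eqMono-addMono a b e =
    ⇔→≡ (mk⇔ (to T-≡ ∘ sum⇒split ∘ from T-≡) (to T-≡ ∘ split⇒sum ∘ from T-≡))
    where
    sum⇒split : T (eqMono (addMono a b) e) → T (leMono a e ∧ eqMono b (subMono e a))
    sum⇒split t = from T-∧ (≤⇒leMono a e a≤e , ≋⇒eqMono b (subMono e a) b≋e-a)
      where
      a+b≋e = eqMono⇒≋ (addMono a b) e t
      a+b≡e : ∀ i → get a i + get b i ≡ get e i
      a+b≡e i = trans (sym (get-addMono a b i)) (get-≡ a+b≋e i)
      a≤e : ∀ i → get a i ≤ get e i
      a≤e i = subst (get a i ≤_) (a+b≡e i) (m≤m+n _ _)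
      b≋e-a : b ≋ subMono e a
      b≋e-a = mk≋ λ i → trans (sym (m+n∸m≡n (get a i) (get b i)))
                  (trans (cong (_∸ get a i) (a+b≡e i)) (sym (get-subMono e a i)))
    split⇒sum : T (leMono a e ∧ eqMono b (subMono e a)) → T (eqMono (addMono a b) e)
    split⇒sum t = ≋⇒eqMono (addMono a b) e (mk≋ λ i → begin
      get (addMono a b) i           ≡⟨ get-addMono a b i ⟩
      get a i + get b i             ≡⟨ cong (get a i +_) (trans (get-≡ b≋e-a i) (get-subMono e a i)) ⟩
      get a i + (get e i ∸ get a i) ≡⟨ m+[n∸m]≡n (a≤e i) ⟩
      get e i                       ∎)
      where
      open ≡-Reasoning
      a≤e = leMono⇒≤ a e (proj₁ (to T-∧ t))
      b≋e-a = eqMono⇒≋ b (subMono e a) (proj₂ (to T-∧ t))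

  -- The exponent vector of β_{l+1}.
  unitMono : ℕ → Mono
  unitMono zero    = 1 ∷ []
  unitMono (suc l) = 0 ∷ unitMono l

  get-unitMono-same : ∀ l → get (unitMono l) l ≡ 1
  get-unitMono-same zero    = refl
  get-unitMono-same (suc l) = get-unitMono-same l

  get-unitMono-other : ∀ {l i} → i ≢ l → get (unitMono l) i ≡ 0
  get-unitMono-other {zero}  {zero}  i≢l = ⊥-elim (i≢l refl)
  get-unitMono-other {zero}  {suc i} i≢l = refl
  get-unitMono-other {suc l} {zero}  i≢l = refl
  get-unitMono-other {suc l} {suc i} i≢l = get-unitMono-other (i≢l ∘ cong suc)

  unitMono≤ : ∀ {e l} → 0 < get e l → ∀ i → get (unitMono l) i ≤ get e i
  unitMono≤ {e} {l} eₗ>0 i with i ≟ l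
  ... | yes refl = subst (_≤ get e l) (sym (get-unitMono-same l)) eₗ>0
  ... | no  i≢l  = subst (_≤ get e i) (sym (get-unitMono-other i≢l)) z≤n

  get-applyUpTo-< : ∀ k f {l} → l < k → get (applyUpTo f k) l ≡ f l
  get-applyUpTo-< (suc k) f {zero}  _         = refl
  get-applyUpTo-< (suc k) f {suc l} (s≤s l<k) = get-applyUpTo-< k (f ∘ suc) l<k

  get-applyUpTo-≥ : ∀ k f {l} → k ≤ l → get (applyUpTo f k) l ≡ 0
  get-applyUpTo-≥ zero    f         _         = refl
  get-applyUpTo-≥ (suc k) f {suc l} (s≤s k≤l) = get-applyUpTo-≥ k (f ∘ suc) k≤l

open Monomials

module PolynomialRing where

  open Monomials
  open import Algebra.Bundles using (CommutativeRing)
  import Algebra.Solver.Ring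
  open import Algebra.Solver.Ring.AlmostCommutativeRing
    using (fromCommutativeRing; _-Raw-AlmostCommutative⟶_; Induced-equivalence)
  open import Algebra.Structures using (IsCommutativeRing)
  open import Data.Bool using (true; false; if_then_else_)
  open import Data.Integer as ℤ using (ℤ; 0ℤ; _+_; _*_; -_)
  open import Data.Integer.Properties
  open import Data.Integer.Tactic.RingSolver using (solve-∀)
  open import Data.List using (List; []; _∷_; _++_; map; concatMap)
  import Data.List.Properties as List
  open import Data.Maybe using (just; nothing)
  open import Data.Product using (_×_; _,_)
  open import Function using (_∘_)
  open import Level using (0ℓ)
  open import Relation.Binary.Definitions using (WeaklyDecidable)
  open import Relation.Binary.PropositionalEquality
  import Relation.Binary.Reasoning.Setoid
  open import Relation.Nullary using (yes; no)

  Term : Set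
  Term = ℤ × Mono

  private variable A B : Set

  sumℤ : (A → ℤ) → List A → ℤ
  sumℤ f []       = 0ℤ
  sumℤ f (x ∷ xs) = f x + sumℤ f xs

  sumℤ-cong : ∀ {f g : A → ℤ} xs → (∀ x → f x ≡ g x) → sumℤ f xs ≡ sumℤ g xs
  sumℤ-cong []       f≗g = refl
  sumℤ-cong (x ∷ xs) f≗g = cong₂ _+_ (f≗g x) (sumℤ-cong xs f≗g)

  sumℤ-++ : ∀ (f : A → ℤ) xs ys → sumℤ f (xs ++ ys) ≡ sumℤ f xs + sumℤ f ys
  sumℤ-++ f []       ys = sym (+-identityˡ _)
  sumℤ-++ f (x ∷ xs) ys = trans (cong (f x +_) (sumℤ-++ f xs ys)) (sym (+-assoc (f x) _ _))

  sumℤ-zero : ∀ (xs : List A) → sumℤ (λ _ → 0ℤ) xs ≡ 0ℤ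
  sumℤ-zero []       = refl
  sumℤ-zero (x ∷ xs) = trans (+-identityˡ _) (sumℤ-zero xs)

  sumℤ-+ : ∀ (f g : A → ℤ) xs → sumℤ (λ x → f x + g x) xs ≡ sumℤ f xs + sumℤ g xs
  sumℤ-+ f g []       = refl
  sumℤ-+ f g (x ∷ xs) = trans (cong (f x + g x +_) (sumℤ-+ f g xs)) (swap (f x) (g x) _ _)
    where
    swap : ∀ a b c d → (a + b) + (c + d) ≡ (a + c) + (b + d)
    swap = solve-∀

  sumℤ-map : ∀ (f : B → ℤ) (g : A → B) xs → sumℤ f (map g xs) ≡ sumℤ (f ∘ g) xs
  sumℤ-map f g []       = refl
  sumℤ-map f g (x ∷ xs) = cong (f (g x) +_) (sumℤ-map f g xs)

  sumℤ-swap : ∀ (f : A → B → ℤ) xs (ys : List B) →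
              sumℤ (λ x → sumℤ (f x) ys) xs ≡ sumℤ (λ y → sumℤ (λ x → f x y) xs) ys
  sumℤ-swap f []       ys = sym (sumℤ-zero ys)
  sumℤ-swap f (x ∷ xs) ys =
    trans (cong (sumℤ (f x) ys +_) (sumℤ-swap f xs ys)) (sym (sumℤ-+ (f x) _ ys))

  termCoeff : Mono → Term → ℤ
  termCoeff e (c , m) = if eqMono m e then c else 0ℤ

  coeff-sumℤ : ∀ p e → coeff p e ≡ sumℤ (termCoeff e) p
  coeff-sumℤ []            e = refl
  coeff-sumℤ ((c , m) ∷ p) e with eqMono m e
  ... | true  = cong (c +_) (coeff-sumℤ p e)
  ... | false = trans (coeff-sumℤ p e) (sym (+-identityˡ _))

  coeff-++ : ∀ p q e → coeff (p ++ q) e ≡ coeff p e + coeff q e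
  coeff-++ p q e = begin
    coeff (p ++ q) e                              ≡⟨ coeff-sumℤ (p ++ q) e ⟩
    sumℤ (termCoeff e) (p ++ q)                   ≡⟨ sumℤ-++ (termCoeff e) p q ⟩
    sumℤ (termCoeff e) p + sumℤ (termCoeff e) q   ≡⟨ cong₂ _+_ (coeff-sumℤ p e) (coeff-sumℤ q e) ⟨
    coeff p e + coeff q e                         ∎
    where open ≡-Reasoning

  coeff-pneg : ∀ p e → coeff (pneg p) e ≡ - coeff p e
  coeff-pneg []            e = refl
  coeff-pneg ((c , m) ∷ p) e with eqMono m e
  ... | true  = trans (cong (- c +_) (coeff-pneg p e)) (sym (neg-distrib-+ c _))
  ... | false = coeff-pneg p e

  mulTerm : Term → Term → Term
  mulTerm (c , m) (d , n) = (c * d , addMono m n)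

  coeff-concatMap : ∀ (g : A → Poly) xs e → coeff (concatMap g xs) e ≡ sumℤ (λ x → coeff (g x) e) xs
  coeff-concatMap g []       e = refl
  coeff-concatMap g (x ∷ xs) e =
    trans (coeff-++ (g x) (concatMap g xs) e) (cong (coeff (g x) e +_) (coeff-concatMap g xs e))

  mulTerm-comm : ∀ a b → mulTerm a b ≡ mulTerm b a
  mulTerm-comm (c , m) (d , n) = cong₂ _,_ (*-comm c d) (addMono-comm m n)

  mulTerm-assoc : ∀ a b c → mulTerm (mulTerm a b) c ≡ mulTerm a (mulTerm b c)
  mulTerm-assoc (c , m) (d , n) (f , o) = cong₂ _,_ (*-assoc c d f) (addMono-assoc m n o)

  module _ (c : ℤ) (m e : Mono) where

    coeff-map-mulTerm-≤ : leMono m e ≡ true → ∀ q →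
                          coeff (map (mulTerm (c , m)) q) e ≡ c * coeff q (subMono e m)
    coeff-map-mulTerm-≤ m≤e []            = sym (*-zeroʳ c)
    coeff-map-mulTerm-≤ m≤e ((d , n) ∷ q) rewrite eqMono-addMono m n e | m≤e
      with eqMono n (subMono e m)
    ... | true  = trans (cong (c * d +_) (coeff-map-mulTerm-≤ m≤e q)) (sym (*-distribˡ-+ c d _))
    ... | false = coeff-map-mulTerm-≤ m≤e q

    coeff-map-mulTerm-≰ : leMono m e ≡ false → ∀ q → coeff (map (mulTerm (c , m)) q) e ≡ 0ℤ
    coeff-map-mulTerm-≰ m≰e []            = refl
    coeff-map-mulTerm-≰ m≰e ((d , n) ∷ q) rewrite eqMono-addMono m n e | m≰e =
      coeff-map-mulTerm-≰ m≰e q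

  infix 4 _≈_

  record _≈_ (p q : Poly) : Set where
    constructor mk≈
    field coeff-≡ : ∀ e → coeff p e ≡ coeff q e

  open _≈_ public

  ≈-refl : ∀ {p} → p ≈ p
  ≈-refl = mk≈ λ _ → refl

  ≈-sym : ∀ {p q} → p ≈ q → q ≈ p
  ≈-sym p≈q = mk≈ λ e → sym (coeff-≡ p≈q e)

  ≈-trans : ∀ {p q r} → p ≈ q → q ≈ r → p ≈ r
  ≈-trans p≈q q≈r = mk≈ λ e → trans (coeff-≡ p≈q e) (coeff-≡ q≈r e)

  ≈-reflexive : ∀ {p q} → p ≡ q → p ≈ q
  ≈-reflexive refl = ≈-refl

  ++-cong : ∀ {p p′ q q′} → p ≈ p′ → q ≈ q′ → p ++ q ≈ p′ ++ q′
  ++-cong {p} {p′} {q} {q′} p≈p′ q≈q′ = mk≈ λ e → begin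
    coeff (p ++ q) e       ≡⟨ coeff-++ p q e ⟩
    coeff p e + coeff q e  ≡⟨ cong₂ _+_ (coeff-≡ p≈p′ e) (coeff-≡ q≈q′ e) ⟩
    coeff p′ e + coeff q′ e ≡⟨ coeff-++ p′ q′ e ⟨
    coeff (p′ ++ q′) e     ∎
    where open ≡-Reasoning

  ++-congˡ : ∀ p {q q′} → q ≈ q′ → p ++ q ≈ p ++ q′
  ++-congˡ p = ++-cong (≈-refl {p})

  ++-congʳ : ∀ {p p′} q → p ≈ p′ → p ++ q ≈ p′ ++ q
  ++-congʳ q p≈p′ = ++-cong p≈p′ (≈-refl {q})

  ++-comm : ∀ p q → p ++ q ≈ q ++ p
  ++-comm p q = mk≈ λ e →
    trans (coeff-++ p q e) (trans (+-comm (coeff p e) (coeff q e)) (sym (coeff-++ q p e)))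

  ++-inverseʳ : ∀ p → p ++ pneg p ≈ pzero
  ++-inverseʳ p = mk≈ λ e →
    trans (coeff-++ p (pneg p) e) (trans (cong (coeff p e +_) (coeff-pneg p e)) (+-inverseʳ (coeff p e)))

  pneg-cong : ∀ {p q} → p ≈ q → pneg p ≈ pneg q
  pneg-cong {p} {q} p≈q = mk≈ λ e →
    trans (coeff-pneg p e) (trans (cong -_ (coeff-≡ p≈q e)) (sym (coeff-pneg q e)))

  pmul-congˡ : ∀ p {q q′} → q ≈ q′ → pmul p q ≈ pmul p q′
  pmul-congˡ p {q} {q′} q≈q′ = mk≈ λ e →
    trans (coeff-concatMap _ p e) (trans (sumℤ-cong p (same-row e)) (sym (coeff-concatMap _ p e)))
    where
    same-row : ∀ e a → coeff (map (mulTerm a) q) e ≡ coeff (map (mulTerm a) q′) e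
    same-row e (c , m) with leMono m e in m≤e
    ... | true  = trans (coeff-map-mulTerm-≤ c m e m≤e q)
                    (trans (cong (c *_) (coeff-≡ q≈q′ _)) (sym (coeff-map-mulTerm-≤ c m e m≤e q′)))
    ... | false = trans (coeff-map-mulTerm-≰ c m e m≤e q) (sym (coeff-map-mulTerm-≰ c m e m≤e q′))

  coeff-pmul : ∀ p q e → coeff (pmul p q) e ≡ sumℤ (λ a → sumℤ (λ b → termCoeff e (mulTerm a b)) q) p
  coeff-pmul p q e = begin
    coeff (pmul p q) e
      ≡⟨ coeff-concatMap _ p e ⟩
    sumℤ (λ a → coeff (map (mulTerm a) q) e) p
      ≡⟨ sumℤ-cong p (λ a → coeff-sumℤ (map (mulTerm a) q) e) ⟩
    sumℤ (λ a → sumℤ (termCoeff e) (map (mulTerm a) q)) p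
      ≡⟨ sumℤ-cong p (λ a → sumℤ-map _ (mulTerm a) q) ⟩
    sumℤ (λ a → sumℤ (λ b → termCoeff e (mulTerm a b)) q) p
      ∎
    where open ≡-Reasoning

  pmul-comm : ∀ p q → pmul p q ≈ pmul q p
  pmul-comm p q = mk≈ λ e → begin
    coeff (pmul p q) e                                       ≡⟨ coeff-pmul p q e ⟩
    sumℤ (λ a → sumℤ (λ b → termCoeff e (mulTerm a b)) q) p  ≡⟨ sumℤ-swap _ p q ⟩
    sumℤ (λ b → sumℤ (λ a → termCoeff e (mulTerm a b)) p) q  ≡⟨ sumℤ-cong q (λ b → sumℤ-cong p λ a →
                                                                   cong (termCoeff e) (mulTerm-comm a b)) ⟩
    sumℤ (λ b → sumℤ (λ a → termCoeff e (mulTerm b a)) p) q  ≡⟨ coeff-pmul q p e ⟨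
    coeff (pmul q p) e                                       ∎
    where open ≡-Reasoning

  pmul-congʳ : ∀ {p p′} q → p ≈ p′ → pmul p q ≈ pmul p′ q
  pmul-congʳ {p} {p′} q p≈p′ = ≈-trans (pmul-comm p q) (≈-trans (pmul-congˡ q p≈p′) (pmul-comm q p′))

  pmul-cong : ∀ {p p′ q q′} → p ≈ p′ → q ≈ q′ → pmul p q ≈ pmul p′ q′
  pmul-cong {p′ = p′} {q} p≈p′ q≈q′ = ≈-trans (pmul-congʳ q p≈p′) (pmul-congˡ p′ q≈q′)

  pmul-distribʳ : ∀ p q r → pmul (p ++ q) r ≡ pmul p r ++ pmul q r
  pmul-distribʳ []      q r = refl
  pmul-distribʳ (a ∷ p) q r = trans (cong (map (mulTerm a) r ++_) (pmul-distribʳ p q r))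
                                    (sym (List.++-assoc (map (mulTerm a) r) (pmul p r) (pmul q r)))

  pmul-distribˡ : ∀ p q r → pmul p (q ++ r) ≈ pmul p q ++ pmul p r
  pmul-distribˡ p q r =
    ≈-trans (pmul-comm p (q ++ r))
      (≈-trans (≈-reflexive (pmul-distribʳ q r p)) (++-cong (pmul-comm q p) (pmul-comm r p)))

  pmul-map-mulTerm : ∀ a q r → pmul (map (mulTerm a) q) r ≡ map (mulTerm a) (pmul q r)
  pmul-map-mulTerm a q r = begin
    concatMap (λ b → map (mulTerm b) r) (map (mulTerm a) q)        ≡⟨ List.concatMap-map _ (mulTerm a) q ⟩
    concatMap (λ b → map (mulTerm (mulTerm a b)) r) q              ≡⟨ List.concatMap-cong (λ b →
                                                                     trans (List.map-cong (mulTerm-assoc a b) r)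
                                                                           (List.map-∘ r)) q ⟩
    concatMap (λ b → map (mulTerm a) (map (mulTerm b) r)) q        ≡⟨ List.map-concatMap (mulTerm a) _ q ⟨
    map (mulTerm a) (concatMap (λ b → map (mulTerm b) r) q)        ∎
    where open ≡-Reasoning

  pmul-assoc : ∀ p q r → pmul (pmul p q) r ≡ pmul p (pmul q r)
  pmul-assoc []      q r = refl
  pmul-assoc (a ∷ p) q r = begin
    pmul (map (mulTerm a) q ++ pmul p q) r                ≡⟨ pmul-distribʳ (map (mulTerm a) q) (pmul p q) r ⟩
    pmul (map (mulTerm a) q) r ++ pmul (pmul p q) r
                                                          ≡⟨ cong₂ _++_ (pmul-map-mulTerm a q r) (pmul-assoc p q r) ⟩
    map (mulTerm a) (pmul q r) ++ pmul p (pmul q r)       ∎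
    where open ≡-Reasoning

  pmul-zeroʳ : ∀ p → pmul p pzero ≡ pzero
  pmul-zeroʳ []      = refl
  pmul-zeroʳ (a ∷ p) = pmul-zeroʳ p

  pmul-identityˡ : ∀ p → pmul pone p ≡ p
  pmul-identityˡ []            = refl
  pmul-identityˡ ((d , n) ∷ p) = cong₂ _∷_ (cong (_, n) (*-identityˡ d)) (pmul-identityˡ p)

  pmul-identityʳ : ∀ p → pmul p pone ≡ p
  pmul-identityʳ []            = refl
  pmul-identityʳ ((c , m) ∷ p) =
    cong₂ _∷_ (cong₂ _,_ (*-identityʳ c) (addMono-identityʳ m)) (pmul-identityʳ p)

  Poly-isCommutativeRing : IsCommutativeRing _≈_ _++_ pmul pneg pzero pone
  Poly-isCommutativeRing = record
    { isRing = record
      { +-isAbelianGroup = record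
        { isGroup = record
          { isMonoid = record
            { isSemigroup = record
              { isMagma = record
                { isEquivalence = record { refl = ≈-refl ; sym = ≈-sym ; trans = ≈-trans }
                ; ∙-cong        = ++-cong
                }
              ; assoc = λ p q r → ≈-reflexive (List.++-assoc p q r)
              }
            ; identity = (λ _ → ≈-refl) , (λ p → ≈-reflexive (List.++-identityʳ p))
            }
          ; inverse = (λ p → ≈-trans (++-comm (pneg p) p) (++-inverseʳ p)) , ++-inverseʳ
          ; ⁻¹-cong = pneg-cong
          }
        ; comm = ++-comm
        }
      ; *-cong     = pmul-cong
      ; *-assoc    = λ p q r → ≈-reflexive (pmul-assoc p q r)
      ; *-identity = (λ p → ≈-reflexive (pmul-identityˡ p)) , (λ p → ≈-reflexive (pmul-identityʳ p))
      ; distrib    = pmul-distribˡ , (λ r p q → ≈-reflexive (pmul-distribʳ p q r))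
      }
    ; *-comm = pmul-comm
    }

  Poly-commutativeRing : CommutativeRing 0ℓ 0ℓ
  Poly-commutativeRing = record { isCommutativeRing = Poly-isCommutativeRing }

  module ≈-Reasoning = Relation.Binary.Reasoning.Setoid (CommutativeRing.setoid Poly-commutativeRing)

  -- The ring solver gets integer coefficients: over Poly itself it could not recognise c - c as zero.
  constant : ℤ → Poly
  constant n = (n , []) ∷ []

  constant-morphism : ℤ.+-*-rawRing -Raw-AlmostCommutative⟶ fromCommutativeRing Poly-commutativeRing
  constant-morphism = record
    { ⟦_⟧    = constant
    ; +-homo = λ a b → mk≈ (+-homo a b)
    ; *-homo = λ _ _ → ≈-refl
    ; -‿homo = λ _ → ≈-refl
    ; 0-homo = mk≈ 0-homo
    ; 1-homo = ≈-refl
    }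
    where
    +-homo : ∀ a b e → coeff (constant (a + b)) e ≡ coeff (constant a ++ constant b) e
    +-homo a b e with eqMono [] e
    ... | true  = trans (+-identityʳ (a + b)) (cong (a +_) (sym (+-identityʳ b)))
    ... | false = refl
    0-homo : ∀ e → coeff (constant 0ℤ) e ≡ 0ℤ
    0-homo e with eqMono [] e
    ... | true  = refl
    ... | false = refl

  constant-≟ : WeaklyDecidable (Induced-equivalence constant-morphism)
  constant-≟ a b with a ≟ b
  ... | yes refl = just ≈-refl
  ... | no  _    = nothing

  open Algebra.Solver.Ring ℤ.+-*-rawRing (fromCommutativeRing Poly-commutativeRing) constant-morphism constant-≟
    using (solve; _:=_; _:+_; _:*_; :-_) public

open PolynomialRing

module UPolynomials where

  open PolynomialRing
  open import Data.List using ([]; _∷_; _++_; take)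
  import Data.List.Properties as List
  open import Data.Nat using (zero; suc; _<_; _≤_; s≤s)
  open import Level using (0ℓ)
  open import Relation.Binary.Bundles using (Setoid)
  open import Relation.Binary.PropositionalEquality using (_≡_; refl; sym)
  import Relation.Binary.Reasoning.Setoid

  infix 4 _≈ᵤ_

  record _≈ᵤ_ (f g : UPoly) : Set where
    constructor mk≈ᵤ
    field nthP-≈ : ∀ n → nthP f n ≈ nthP g n

  open _≈ᵤ_ public

  ≈ᵤ-refl : ∀ {f} → f ≈ᵤ f
  ≈ᵤ-refl = mk≈ᵤ λ _ → ≈-refl

  ≈ᵤ-sym : ∀ {f g} → f ≈ᵤ g → g ≈ᵤ f
  ≈ᵤ-sym f≈g = mk≈ᵤ λ n → ≈-sym (nthP-≈ f≈g n)

  ≈ᵤ-trans : ∀ {f g h} → f ≈ᵤ g → g ≈ᵤ h → f ≈ᵤ h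
  ≈ᵤ-trans f≈g g≈h = mk≈ᵤ λ n → ≈-trans (nthP-≈ f≈g n) (nthP-≈ g≈h n)

  ≈ᵤ-reflexive : ∀ {f g} → f ≡ g → f ≈ᵤ g
  ≈ᵤ-reflexive refl = ≈ᵤ-refl

  UPoly-setoid : Setoid 0ℓ 0ℓ
  UPoly-setoid = record
    { Carrier       = UPoly
    ; _≈_           = _≈ᵤ_
    ; isEquivalence = record { refl = ≈ᵤ-refl ; sym = ≈ᵤ-sym ; trans = ≈ᵤ-trans }
    }

  module ≈ᵤ-Reasoning = Relation.Binary.Reasoning.Setoid UPoly-setoid

  nthP-uadd : ∀ f g n → nthP (uadd f g) n ≈ nthP f n ++ nthP g n
  nthP-uadd []      g       n       = ≈-refl
  nthP-uadd (a ∷ f) []      n       = ≈-reflexive (sym (List.++-identityʳ _))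
  nthP-uadd (a ∷ f) (b ∷ g) zero    = ≈-refl
  nthP-uadd (a ∷ f) (b ∷ g) (suc n) = nthP-uadd f g n

  nthP-uscale : ∀ c f n → nthP (uscale c f) n ≈ pmul c (nthP f n)
  nthP-uscale c []      n       = ≈-reflexive (sym (pmul-zeroʳ c))
  nthP-uscale c (a ∷ f) zero    = ≈-refl
  nthP-uscale c (a ∷ f) (suc n) = nthP-uscale c f n

  nthP-take-< : ∀ d f {n} → n < d → nthP (take d f) n ≡ nthP f n
  nthP-take-< (suc d) []      _         = refl
  nthP-take-< (suc d) (a ∷ f) {zero}  _ = refl
  nthP-take-< (suc d) (a ∷ f) {suc n} (s≤s n<d) = nthP-take-< d f n<d

  nthP-take-≥ : ∀ d f {n} → d ≤ n → nthP (take d f) n ≡ pzero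
  nthP-take-≥ zero    f       _         = refl
  nthP-take-≥ (suc d) []      _         = refl
  nthP-take-≥ (suc d) (a ∷ f) (s≤s d≤n) = nthP-take-≥ d f d≤n

  ∷-cong : ∀ {a a′ f f′} → a ≈ a′ → f ≈ᵤ f′ → a ∷ f ≈ᵤ a′ ∷ f′
  ∷-cong a≈a′ f≈f′ = mk≈ᵤ λ { zero → a≈a′ ; (suc n) → nthP-≈ f≈f′ n }

  pzero∷[]≈[] : pzero ∷ [] ≈ᵤ []
  pzero∷[]≈[] = mk≈ᵤ λ { zero → ≈-refl ; (suc n) → ≈-refl }

  uadd-identityʳ : ∀ f → uadd f [] ≡ f
  uadd-identityʳ []      = refl
  uadd-identityʳ (a ∷ f) = refl

  uadd-cong : ∀ {f f′ g g′} → f ≈ᵤ f′ → g ≈ᵤ g′ → uadd f g ≈ᵤ uadd f′ g′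
  uadd-cong {f} {f′} {g} {g′} f≈f′ g≈g′ = mk≈ᵤ λ n → begin
    nthP (uadd f g) n        ≈⟨ nthP-uadd f g n ⟩
    nthP f n ++ nthP g n     ≈⟨ ++-cong (nthP-≈ f≈f′ n) (nthP-≈ g≈g′ n) ⟩
    nthP f′ n ++ nthP g′ n   ≈⟨ nthP-uadd f′ g′ n ⟨
    nthP (uadd f′ g′) n      ∎
    where open ≈-Reasoning

  uadd-congʳ : ∀ {f f′} g → f ≈ᵤ f′ → uadd f g ≈ᵤ uadd f′ g
  uadd-congʳ g f≈f′ = uadd-cong f≈f′ (≈ᵤ-refl {g})

  uadd-congˡ : ∀ f {g g′} → g ≈ᵤ g′ → uadd f g ≈ᵤ uadd f g′
  uadd-congˡ f g≈g′ = uadd-cong (≈ᵤ-refl {f}) g≈g′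

  uscale-cong : ∀ {c c′ f f′} → c ≈ c′ → f ≈ᵤ f′ → uscale c f ≈ᵤ uscale c′ f′
  uscale-cong {c} {c′} {f} {f′} c≈c′ f≈f′ = mk≈ᵤ λ n → begin
    nthP (uscale c f) n      ≈⟨ nthP-uscale c f n ⟩
    pmul c (nthP f n)        ≈⟨ pmul-cong c≈c′ (nthP-≈ f≈f′ n) ⟩
    pmul c′ (nthP f′ n)      ≈⟨ nthP-uscale c′ f′ n ⟨
    nthP (uscale c′ f′) n    ∎
    where open ≈-Reasoning

  uscale-congˡ : ∀ c {f f′} → f ≈ᵤ f′ → uscale c f ≈ᵤ uscale c f′
  uscale-congˡ c = uscale-cong (≈-refl {c})

  uscale-congʳ : ∀ {c c′} f → c ≈ c′ → uscale c f ≈ᵤ uscale c′ f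
  uscale-congʳ f c≈c′ = uscale-cong c≈c′ (≈ᵤ-refl {f})

  uadd-comm : ∀ f g → uadd f g ≈ᵤ uadd g f
  uadd-comm f g = mk≈ᵤ λ n → begin
    nthP (uadd f g) n      ≈⟨ nthP-uadd f g n ⟩
    nthP f n ++ nthP g n   ≈⟨ ++-comm (nthP f n) (nthP g n) ⟩
    nthP g n ++ nthP f n   ≈⟨ nthP-uadd g f n ⟨
    nthP (uadd g f) n      ∎
    where open ≈-Reasoning

  uadd-assoc : ∀ f g h → uadd (uadd f g) h ≈ᵤ uadd f (uadd g h)
  uadd-assoc f g h = mk≈ᵤ λ n → begin
    nthP (uadd (uadd f g) h) n               ≈⟨ nthP-uadd (uadd f g) h n ⟩
    nthP (uadd f g) n ++ nthP h n            ≈⟨ ++-congʳ (nthP h n) (nthP-uadd f g n) ⟩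
    (nthP f n ++ nthP g n) ++ nthP h n       ≈⟨ ≈-reflexive (List.++-assoc (nthP f n) _ _) ⟩
    nthP f n ++ (nthP g n ++ nthP h n)       ≈⟨ ++-congˡ (nthP f n) (nthP-uadd g h n) ⟨
    nthP f n ++ nthP (uadd g h) n            ≈⟨ nthP-uadd f (uadd g h) n ⟨
    nthP (uadd f (uadd g h)) n               ∎
    where open ≈-Reasoning

  uscale-distribˡ : ∀ c f g → uscale c (uadd f g) ≈ᵤ uadd (uscale c f) (uscale c g)
  uscale-distribˡ c f g = mk≈ᵤ λ n → begin
    nthP (uscale c (uadd f g)) n                     ≈⟨ nthP-uscale c (uadd f g) n ⟩
    pmul c (nthP (uadd f g) n)                       ≈⟨ pmul-congˡ c (nthP-uadd f g n) ⟩
    pmul c (nthP f n ++ nthP g n)                    ≈⟨ pmul-distribˡ c (nthP f n) (nthP g n) ⟩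
    pmul c (nthP f n) ++ pmul c (nthP g n)           ≈⟨ ++-cong (nthP-uscale c f n) (nthP-uscale c g n) ⟨
    nthP (uscale c f) n ++ nthP (uscale c g) n       ≈⟨ nthP-uadd (uscale c f) (uscale c g) n ⟨
    nthP (uadd (uscale c f) (uscale c g)) n          ∎
    where open ≈-Reasoning

  uscale-distribʳ : ∀ c d f → uscale (c ++ d) f ≈ᵤ uadd (uscale c f) (uscale d f)
  uscale-distribʳ c d f = mk≈ᵤ λ n → begin
    nthP (uscale (c ++ d) f) n                       ≈⟨ nthP-uscale (c ++ d) f n ⟩
    pmul (c ++ d) (nthP f n)                         ≈⟨ ≈-reflexive (pmul-distribʳ c d (nthP f n)) ⟩
    pmul c (nthP f n) ++ pmul d (nthP f n)           ≈⟨ ++-cong (nthP-uscale c f n) (nthP-uscale d f n) ⟨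
    nthP (uscale c f) n ++ nthP (uscale d f) n       ≈⟨ nthP-uadd (uscale c f) (uscale d f) n ⟨
    nthP (uadd (uscale c f) (uscale d f)) n          ∎
    where open ≈-Reasoning

  uscale-assoc : ∀ c d f → uscale (pmul c d) f ≈ᵤ uscale c (uscale d f)
  uscale-assoc c d f = mk≈ᵤ λ n → begin
    nthP (uscale (pmul c d) f) n          ≈⟨ nthP-uscale (pmul c d) f n ⟩
    pmul (pmul c d) (nthP f n)            ≈⟨ ≈-reflexive (pmul-assoc c d (nthP f n)) ⟩
    pmul c (pmul d (nthP f n))            ≈⟨ pmul-congˡ c (nthP-uscale d f n) ⟨
    pmul c (nthP (uscale d f) n)          ≈⟨ nthP-uscale c (uscale d f) n ⟨
    nthP (uscale c (uscale d f)) n        ∎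
    where open ≈-Reasoning

  uscale-identity : ∀ f → uscale pone f ≈ᵤ f
  uscale-identity f = mk≈ᵤ λ n → ≈-trans (nthP-uscale pone f n) (≈-reflexive (pmul-identityˡ (nthP f n)))

  uscale-zero : ∀ {c} f → c ≈ pzero → uscale c f ≈ᵤ []
  uscale-zero {c} f c≈0 = mk≈ᵤ λ n → ≈-trans (nthP-uscale c f n) (pmul-congʳ (nthP f n) c≈0)

  uadd-left-comm : ∀ f g h → uadd f (uadd g h) ≈ᵤ uadd g (uadd f h)
  uadd-left-comm f g h = begin
    uadd f (uadd g h)   ≈⟨ uadd-assoc f g h ⟨
    uadd (uadd f g) h   ≈⟨ uadd-congʳ h (uadd-comm f g) ⟩
    uadd (uadd g f) h   ≈⟨ uadd-assoc g f h ⟩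
    uadd g (uadd f h)   ∎
    where open ≈ᵤ-Reasoning

  uadd-interchange : ∀ f g h k → uadd (uadd f g) (uadd h k) ≈ᵤ uadd (uadd f h) (uadd g k)
  uadd-interchange f g h k = begin
    uadd (uadd f g) (uadd h k)   ≈⟨ uadd-assoc f g (uadd h k) ⟩
    uadd f (uadd g (uadd h k))   ≈⟨ uadd-congˡ f (uadd-left-comm g h k) ⟩
    uadd f (uadd h (uadd g k))   ≈⟨ uadd-assoc f h (uadd g k) ⟨
    uadd (uadd f h) (uadd g k)   ∎
    where open ≈ᵤ-Reasoning

  umul-congˡ : ∀ f {g g′} → g ≈ᵤ g′ → umul f g ≈ᵤ umul f g′
  umul-congˡ []      _    = ≈ᵤ-refl
  umul-congˡ (a ∷ f) g≈g′ = uadd-cong (uscale-congˡ a g≈g′) (∷-cong ≈-refl (umul-congˡ f g≈g′))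

  umul-zeroʳ : ∀ f → umul f [] ≈ᵤ []
  umul-zeroʳ []      = ≈ᵤ-refl
  umul-zeroʳ (a ∷ f) = ≈ᵤ-trans (∷-cong ≈-refl (umul-zeroʳ f)) pzero∷[]≈[]

  umul-∷ʳ : ∀ f a g → umul f (a ∷ g) ≈ᵤ uadd (uscale a f) (pzero ∷ umul f g)
  umul-∷ʳ []      a g = ≈ᵤ-sym pzero∷[]≈[]
  umul-∷ʳ (b ∷ f) a g = ∷-cong (++-congʳ pzero (pmul-comm b a)) (begin
    uadd (uscale b g) (umul f (a ∷ g))                           ≈⟨ uadd-congˡ (uscale b g) (umul-∷ʳ f a g) ⟩
    uadd (uscale b g) (uadd (uscale a f) (pzero ∷ umul f g))     ≈⟨ uadd-left-comm (uscale b g) (uscale a f) _ ⟩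
    uadd (uscale a f) (uadd (uscale b g) (pzero ∷ umul f g))     ∎)
    where open ≈ᵤ-Reasoning

  umul-comm : ∀ f g → umul f g ≈ᵤ umul g f
  umul-comm []      g = ≈ᵤ-sym (umul-zeroʳ g)
  umul-comm (a ∷ f) g =
    ≈ᵤ-trans (uadd-congˡ (uscale a g) (∷-cong ≈-refl (umul-comm f g))) (≈ᵤ-sym (umul-∷ʳ g a f))

  umul-congʳ : ∀ {f f′} g → f ≈ᵤ f′ → umul f g ≈ᵤ umul f′ g
  umul-congʳ {f} {f′} g f≈f′ =
    ≈ᵤ-trans (umul-comm f g) (≈ᵤ-trans (umul-congˡ g f≈f′) (umul-comm g f′))

  umul-identityʳ : ∀ f → umul f (pone ∷ []) ≈ᵤ f
  umul-identityʳ f = begin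
    umul f (pone ∷ [])                          ≈⟨ umul-∷ʳ f pone [] ⟩
    uadd (uscale pone f) (pzero ∷ umul f [])    ≈⟨ uadd-cong (uscale-identity f) (∷-cong ≈-refl (umul-zeroʳ f)) ⟩
    uadd f (pzero ∷ [])                         ≈⟨ uadd-congˡ f pzero∷[]≈[] ⟩
    uadd f []                                   ≡⟨ uadd-identityʳ f ⟩
    f                                           ∎
    where open ≈ᵤ-Reasoning

  umul-uaddˡ : ∀ f g h → umul (uadd f g) h ≈ᵤ uadd (umul f h) (umul g h)
  umul-uaddˡ []      g       h = ≈ᵤ-refl
  umul-uaddˡ (a ∷ f) []      h = ≈ᵤ-reflexive (sym (uadd-identityʳ _))
  umul-uaddˡ (a ∷ f) (b ∷ g) h = begin
    uadd (uscale (a ++ b) h) (pzero ∷ umul (uadd f g) h)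
      ≈⟨ uadd-cong (uscale-distribʳ a b h) (∷-cong ≈-refl (umul-uaddˡ f g h)) ⟩
    uadd (uadd (uscale a h) (uscale b h)) (uadd (pzero ∷ umul f h) (pzero ∷ umul g h))
      ≈⟨ uadd-interchange (uscale a h) (uscale b h) _ _ ⟩
    uadd (uadd (uscale a h) (pzero ∷ umul f h)) (uadd (uscale b h) (pzero ∷ umul g h))
      ∎
    where open ≈ᵤ-Reasoning

  umul-uscaleˡ : ∀ c f g → umul (uscale c f) g ≈ᵤ uscale c (umul f g)
  umul-uscaleˡ c []      g = ≈ᵤ-refl
  umul-uscaleˡ c (a ∷ f) g = begin
    uadd (uscale (pmul c a) g) (pzero ∷ umul (uscale c f) g)
      ≈⟨ uadd-cong (uscale-assoc c a g) (∷-cong ≈-refl (umul-uscaleˡ c f g)) ⟩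
    uadd (uscale c (uscale a g)) (pzero ∷ uscale c (umul f g))
      ≈⟨ uadd-congˡ (uscale c (uscale a g)) (∷-cong (≈-sym (≈-reflexive (pmul-zeroʳ c))) ≈ᵤ-refl) ⟩
    uadd (uscale c (uscale a g)) (uscale c (pzero ∷ umul f g))
      ≈⟨ uscale-distribˡ c (uscale a g) (pzero ∷ umul f g) ⟨
    uscale c (uadd (uscale a g) (pzero ∷ umul f g))
      ∎
    where open ≈ᵤ-Reasoning

  umul-pzero∷ : ∀ f g → umul (pzero ∷ f) g ≈ᵤ pzero ∷ umul f g
  umul-pzero∷ f g = uadd-congʳ (pzero ∷ umul f g) (uscale-zero g ≈-refl)

  umul-assoc : ∀ f g h → umul (umul f g) h ≈ᵤ umul f (umul g h)
  umul-assoc []      g h = ≈ᵤ-refl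
  umul-assoc (a ∷ f) g h = begin
    umul (uadd (uscale a g) (pzero ∷ umul f g)) h
      ≈⟨ umul-uaddˡ (uscale a g) (pzero ∷ umul f g) h ⟩
    uadd (umul (uscale a g) h) (umul (pzero ∷ umul f g) h)
      ≈⟨ uadd-cong (umul-uscaleˡ a g h) (umul-pzero∷ (umul f g) h) ⟩
    uadd (uscale a (umul g h)) (pzero ∷ umul (umul f g) h)
      ≈⟨ uadd-congˡ (uscale a (umul g h)) (∷-cong ≈-refl (umul-assoc f g h)) ⟩
    uadd (uscale a (umul g h)) (pzero ∷ umul f (umul g h))
      ∎
    where open ≈ᵤ-Reasoning

  umul-linear : ∀ f a → umul f (a ∷ pone ∷ []) ≈ᵤ uadd (pzero ∷ f) (uscale a f)
  umul-linear f a = begin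
    umul f (a ∷ pone ∷ [])                            ≈⟨ umul-∷ʳ f a (pone ∷ []) ⟩
    uadd (uscale a f) (pzero ∷ umul f (pone ∷ []))    ≈⟨ uadd-congˡ (uscale a f) (∷-cong ≈-refl (umul-identityʳ f)) ⟩
    uadd (uscale a f) (pzero ∷ f)                     ≈⟨ uadd-comm (uscale a f) (pzero ∷ f) ⟩
    uadd (pzero ∷ f) (uscale a f)                     ∎
    where open ≈ᵤ-Reasoning

open UPolynomials

module SigmaBasis where

  open PolynomialRing
  open UPolynomials
  open import Data.Bool using (T; true; false)
  open import Data.Bool.Properties using (T-≡)
  open import Data.Empty using (⊥-elim)
  open import Data.List using ([]; _∷_; _++_; take)
  open import Data.Nat using (ℕ; zero; suc; _<_; _≤_; _≡ᵇ_; _<ᵇ_; s≤s; z≤n)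
  open import Data.Nat.Properties
  open import Data.Sum using (inj₁; inj₂)
  open import Function.Bundles using (Equivalence)
  open import Relation.Binary.PropositionalEquality using (_≡_; refl; sym; subst)
  open import Relation.Nullary using (yes; no)
  open Equivalence using (from)

  sigma-suc : ∀ p → sigma (suc p) ≈ᵤ uadd (pzero ∷ sigma p) (uscale (pneg (bsum (suc p))) (sigma p))
  sigma-suc p = umul-linear (sigma p) (pneg (bsum (suc p)))

  nthP-sigma-suc : ∀ p n → nthP (sigma (suc p)) (suc n) ≈
                           nthP (sigma p) n ++ pmul (pneg (bsum (suc p))) (nthP (sigma p) (suc n))
  nthP-sigma-suc p n = begin
    nthP (sigma (suc p)) (suc n)
      ≈⟨ nthP-≈ (sigma-suc p) (suc n) ⟩
    nthP (uadd (pzero ∷ sigma p) (uscale b (sigma p))) (suc n)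
      ≈⟨ nthP-uadd (pzero ∷ sigma p) (uscale b (sigma p)) (suc n) ⟩
    nthP (sigma p) n ++ nthP (uscale b (sigma p)) (suc n)
      ≈⟨ ++-congˡ (nthP (sigma p) n) (nthP-uscale b (sigma p) (suc n)) ⟩
    nthP (sigma p) n ++ pmul b (nthP (sigma p) (suc n))
      ∎
    where
    open ≈-Reasoning
    b = pneg (bsum (suc p))

  sigma-vanishes : ∀ {p n} → p < n → nthP (sigma p) n ≈ pzero
  sigma-vanishes {zero}  {suc n} _         = ≈-refl
  sigma-vanishes {suc p} {suc n} (s≤s p<n) = begin
    nthP (sigma (suc p)) (suc n)                                    ≈⟨ nthP-sigma-suc p n ⟩
    nthP (sigma p) n ++ pmul b (nthP (sigma p) (suc n))             ≈⟨ ++-cong (sigma-vanishes p<n)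
                                                                         (pmul-congˡ b (sigma-vanishes (m≤n⇒m≤1+n p<n))) ⟩
    pzero ++ pmul b pzero                                           ≈⟨ ≈-reflexive (pmul-zeroʳ b) ⟩
    pzero                                                           ∎
    where
    open ≈-Reasoning
    b = pneg (bsum (suc p))

  sigma-monic : ∀ p → nthP (sigma p) p ≈ pone
  sigma-monic zero    = ≈-refl
  sigma-monic (suc p) = begin
    nthP (sigma (suc p)) (suc p)                                    ≈⟨ nthP-sigma-suc p p ⟩
    nthP (sigma p) p ++ pmul b (nthP (sigma p) (suc p))             ≈⟨ ++-cong (sigma-monic p)
                                                                         (pmul-congˡ b (sigma-vanishes (n<1+n p))) ⟩
    pone ++ pmul b pzero                                            ≈⟨ ++-congˡ pone (≈-reflexive (pmul-zeroʳ b)) ⟩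
    pone                                                            ∎
    where
    open ≈-Reasoning
    b = pneg (bsum (suc p))

  σ-sum : ℕ → (ℕ → Poly) → UPoly
  σ-sum zero    c = uscale (c 0) (sigma 0)
  σ-sum (suc d) c = uadd (σ-sum d c) (uscale (c (suc d)) (sigma (suc d)))

  nthP-uscale-sigma-vanishes : ∀ c {p n} → p < n → nthP (uscale c (sigma p)) n ≈ pzero
  nthP-uscale-sigma-vanishes c {p} {n} p<n =
    ≈-trans (nthP-uscale c (sigma p) n)
      (≈-trans (pmul-congˡ c (sigma-vanishes p<n)) (≈-reflexive (pmul-zeroʳ c)))

  σ-sum-vanishes : ∀ {d} c {n} → d < n → nthP (σ-sum d c) n ≈ pzero
  σ-sum-vanishes {zero}  c     d<n = nthP-uscale-sigma-vanishes (c 0) d<n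
  σ-sum-vanishes {suc d} c {n} d<n =
    ≈-trans (nthP-uadd (σ-sum d c) (uscale (c (suc d)) (sigma (suc d))) n)
      (++-cong (σ-sum-vanishes c (<-trans (n<1+n d) d<n)) (nthP-uscale-sigma-vanishes (c (suc d)) d<n))

  nthP-σ-sum-top : ∀ d c → nthP (σ-sum d c) d ≈ c d
  nthP-σ-sum-top zero    c = ≈-reflexive (pmul-identityʳ (c 0))
  nthP-σ-sum-top (suc d) c = begin
    nthP (σ-sum (suc d) c) (suc d)
      ≈⟨ nthP-uadd (σ-sum d c) (uscale c′ s) (suc d) ⟩
    nthP (σ-sum d c) (suc d) ++ nthP (uscale c′ s) (suc d)
      ≈⟨ ++-cong (σ-sum-vanishes c (n<1+n d)) (nthP-uscale c′ s (suc d)) ⟩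
    pzero ++ pmul c′ (nthP s (suc d))
      ≈⟨ pmul-congˡ c′ (sigma-monic (suc d)) ⟩
    pmul c′ pone
      ≈⟨ ≈-reflexive (pmul-identityʳ c′) ⟩
    c′
      ∎
    where
    open ≈-Reasoning
    c′ = c (suc d)
    s = sigma (suc d)

  σ-sum-cong : ∀ d {c c′} → (∀ p → p ≤ d → c p ≈ c′ p) → σ-sum d c ≈ᵤ σ-sum d c′
  σ-sum-cong zero    c≈c′ = uscale-congʳ (sigma 0) (c≈c′ 0 z≤n)
  σ-sum-cong (suc d) c≈c′ =
    uadd-cong (σ-sum-cong d (λ p p≤d → c≈c′ p (m≤n⇒m≤1+n p≤d)))
              (uscale-congʳ (sigma (suc d)) (c≈c′ (suc d) ≤-refl))

  σ-sum-zero : ∀ d {c} → (∀ p → p ≤ d → c p ≈ pzero) → σ-sum d c ≈ᵤ []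
  σ-sum-zero zero    c≈0 = uscale-zero (sigma 0) (c≈0 0 z≤n)
  σ-sum-zero (suc d) c≈0 =
    uadd-cong (σ-sum-zero d (λ p p≤d → c≈0 p (m≤n⇒m≤1+n p≤d)))
              (uscale-zero (sigma (suc d)) (c≈0 (suc d) ≤-refl))

  σ-sum-sigma : ∀ d {c} → (∀ p → p < d → c p ≈ pzero) → c d ≈ pone → σ-sum d c ≈ᵤ sigma d
  σ-sum-sigma zero    _   cd≈1 = ≈ᵤ-trans (uscale-congʳ (sigma 0) cd≈1) (uscale-identity (sigma 0))
  σ-sum-sigma (suc d) c≈0 cd≈1 =
    uadd-cong (σ-sum-zero d (λ p p≤d → c≈0 p (s≤s p≤d)))
              (≈ᵤ-trans (uscale-congʳ (sigma (suc d)) cd≈1) (uscale-identity (sigma (suc d))))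

  expand-above : ∀ d f {k} → d < k → expand d f k ≡ pzero
  expand-above zero    f {suc k} _   = refl
  expand-above (suc d) f {k}     d<k with k ≡ᵇ suc d in k≡d
  ... | true  = ⊥-elim (<-irrefl (sym (≡ᵇ⇒≡ k (suc d) (from T-≡ k≡d))) d<k)
  ... | false with k <ᵇ suc d in k<d
  ...   | true  = ⊥-elim (<-asym d<k (<ᵇ⇒< k (suc d) (from T-≡ k<d)))
  ...   | false = refl

  σ-sum-peel : ∀ d f c → f ≈ᵤ σ-sum (suc d) c →
               take (suc d) (uadd f (uscale (pneg (nthP f (suc d))) (sigma (suc d)))) ≈ᵤ σ-sum d c
  σ-sum-peel d f c f≈ = mk≈ᵤ coefficient
    where
    S = σ-sum d c
    s = sigma (suc d)
    l = nthP f (suc d)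
    c′ = c (suc d)
    l≈c′ : l ≈ c′
    l≈c′ = ≈-trans (nthP-≈ f≈ (suc d)) (nthP-σ-sum-top (suc d) c)
    g = uadd f (uscale (pneg l) s)
    g≈S : g ≈ᵤ S
    g≈S = begin
      uadd f (uscale (pneg l) s)                          ≈⟨ uadd-cong f≈ (uscale-congʳ s (pneg-cong l≈c′)) ⟩
      uadd (uadd S (uscale c′ s)) (uscale (pneg c′) s)    ≈⟨ uadd-assoc S (uscale c′ s) (uscale (pneg c′) s) ⟩
      uadd S (uadd (uscale c′ s) (uscale (pneg c′) s))    ≈⟨ uadd-congˡ S (uscale-distribʳ c′ (pneg c′) s) ⟨
      uadd S (uscale (c′ ++ pneg c′) s)                   ≈⟨ uadd-congˡ S (uscale-zero s (++-inverseʳ c′)) ⟩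
      uadd S []                                           ≡⟨ uadd-identityʳ S ⟩
      S                                                   ∎
      where open ≈ᵤ-Reasoning
    coefficient : ∀ n → nthP (take (suc d) g) n ≈ nthP S n
    coefficient n with n <? suc d
    ... | yes n≤d rewrite nthP-take-< (suc d) g n≤d = nthP-≈ g≈S n
    ... | no  n≮d rewrite nthP-take-≥ (suc d) g (≮⇒≥ n≮d) = ≈-sym (σ-sum-vanishes c (≮⇒≥ n≮d))

  expand-σ-sum : ∀ d {f c} → f ≈ᵤ σ-sum d c → ∀ {k} → k ≤ d → expand d f k ≈ c k
  expand-σ-sum zero    {f} {c} f≈ {zero} _ = ≈-trans (nthP-≈ f≈ 0) (nthP-σ-sum-top 0 c)
  expand-σ-sum (suc d) {f} {c} f≈ {k} k≤d with k ≡ᵇ suc d in k≡d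
  ... | true rewrite ≡ᵇ⇒≡ k (suc d) (from T-≡ k≡d) =
    ≈-trans (nthP-≈ f≈ (suc d)) (nthP-σ-sum-top (suc d) c)
  ... | false with k <ᵇ suc d in k<d
  ...   | true  = expand-σ-sum d (σ-sum-peel d f c f≈) (<⇒≤pred (<ᵇ⇒< k (suc d) (from T-≡ k<d)))
  ...   | false with m≤n⇒m<n∨m≡n k≤d
  ...     | inj₁ k<d′ = ⊥-elim (subst T k<d (<⇒<ᵇ k<d′))
  ...     | inj₂ k≡d′ = ⊥-elim (subst T k≡d (≡⇒≡ᵇ k (suc d) k≡d′))

open SigmaBasis

module StructureConstants where

  open Monomials
  open PolynomialRing
  open UPolynomials
  open SigmaBasis
  open import Data.Empty using (⊥-elim)
  open import Data.Integer using (1ℤ)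
  open import Data.List using (List; []; _∷_; _++_; map; upTo; cartesianProductWith)
  import Data.List.Properties as List
  open import Data.Nat using (ℕ; zero; suc; _+_; _∸_; _<_; _≤_; s≤s; z≤n)
  open import Data.Nat.Properties
  open import Data.Product using (_,_; map₂)
  open import Function using (_∘_)
  open import Relation.Binary.PropositionalEquality
  open import Relation.Nullary using (yes; no)

  beta-unitMono : ∀ l → beta (suc l) ≡ (1ℤ , unitMono l) ∷ []
  beta-unitMono zero    = refl
  beta-unitMono (suc l) = cong (map (map₂ (0 ∷_))) (beta-unitMono l)

  toPoly : List Mono → Poly
  toPoly = map (1ℤ ,_)

  toPoly-cartesianProductWith : ∀ Ls Ms →
                                toPoly (cartesianProductWith addMono Ls Ms) ≡ pmul (toPoly Ls) (toPoly Ms)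
  toPoly-cartesianProductWith []       Ms = refl
  toPoly-cartesianProductWith (L ∷ Ls) Ms =
    trans (List.map-++ _ (map (addMono L) Ms) _)
          (cong₂ _++_ (trans (sym (List.map-∘ Ms)) (List.map-∘ Ms)) (toPoly-cartesianProductWith Ls Ms))

  interval : ℕ → ℕ → List ℕ
  interval m n = map (m +_) (upTo n)

  upTo-+ : ∀ m n → upTo (m + n) ≡ upTo m ++ interval m n
  upTo-+ m zero    = trans (cong upTo (+-identityʳ m)) (sym (List.++-identityʳ (upTo m)))
  upTo-+ m (suc n) = begin
    upTo (m + suc n)                                 ≡⟨ cong upTo (+-suc m n) ⟩
    upTo (suc (m + n))                               ≡⟨ List.upTo-∷ʳ (m + n) ⟨
    upTo (m + n) ++ (m + n ∷ [])                     ≡⟨ cong (_++ (m + n ∷ [])) (upTo-+ m n) ⟩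
    (upTo m ++ interval m n) ++ (m + n ∷ [])         ≡⟨ List.++-assoc (upTo m) (interval m n) _ ⟩
    upTo m ++ (interval m n ++ (m + n ∷ []))         ≡⟨ cong (upTo m ++_) (List.map-++ (m +_) (upTo n) (n ∷ [])) ⟨
    upTo m ++ map (m +_) (upTo n ++ (n ∷ []))        ≡⟨ cong (λ ns → upTo m ++ map (m +_) ns) (List.upTo-∷ʳ n) ⟩
    upTo m ++ interval m (suc n)                     ∎
    where open ≡-Reasoning

  bsum-upTo : ∀ p → bsum (suc p) ≡ toPoly (map unitMono (upTo p))
  bsum-upTo zero    = refl
  bsum-upTo (suc p) = begin
    bsum (suc p) ++ beta (suc p)
      ≡⟨ cong₂ _++_ (bsum-upTo p) (beta-unitMono p) ⟩
    toPoly (map unitMono (upTo p)) ++ toPoly (unitMono p ∷ [])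
      ≡⟨ List.map-++ _ (map unitMono (upTo p)) _ ⟨
    toPoly (map unitMono (upTo p) ++ (unitMono p ∷ []))
      ≡⟨ cong toPoly (List.map-++ unitMono (upTo p) (p ∷ [])) ⟨
    toPoly (map unitMono (upTo p ++ (p ∷ [])))
      ≡⟨ cong (toPoly ∘ map unitMono) (List.upTo-∷ʳ p) ⟩
    toPoly (map unitMono (upTo (suc p)))
      ∎
    where open ≡-Reasoning

  bdiff : ℕ → ℕ → Poly
  bdiff m p = bsum (suc p) ++ pneg (bsum (suc m))

  bsum-split : ∀ {m p} → m ≤ p →
               bsum (suc p) ≡ toPoly (map unitMono (upTo m)) ++ toPoly (map unitMono (interval m (p ∸ m)))
  bsum-split {m} {p} m≤p = begin
    bsum (suc p)                                     ≡⟨ bsum-upTo p ⟩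
    toPoly (map unitMono (upTo p))                   ≡⟨ cong (toPoly ∘ map unitMono ∘ upTo) (m+[n∸m]≡n m≤p) ⟨
    toPoly (map unitMono (upTo (m + (p ∸ m))))       ≡⟨ cong (toPoly ∘ map unitMono) (upTo-+ m (p ∸ m)) ⟩
    toPoly (map unitMono (upTo m ++ I))              ≡⟨ cong toPoly (List.map-++ unitMono (upTo m) I) ⟩
    toPoly (map unitMono (upTo m) ++ map unitMono I) ≡⟨ List.map-++ _ (map unitMono (upTo m)) (map unitMono I) ⟩
    toPoly (map unitMono (upTo m)) ++ toPoly (map unitMono I)  ∎
    where
    open ≡-Reasoning
    I = interval m (p ∸ m)

  bdiff-interval : ∀ {m p} → m ≤ p → bdiff m p ≈ toPoly (map unitMono (interval m (p ∸ m)))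
  bdiff-interval {m} {p} m≤p = begin
    bsum (suc p) ++ pneg (bsum (suc m))   ≡⟨ cong₂ (λ X Y → X ++ pneg Y) (bsum-split m≤p) (bsum-upTo m) ⟩
    (B ++ I) ++ pneg B                    ≈⟨ solve 2 (λ B I → (B :+ I) :+ (:- B) := I) ≈-refl B I ⟩
    I                                     ∎
    where
    open ≈-Reasoning
    B = toPoly (map unitMono (upTo m))
    I = toPoly (map unitMono (interval m (p ∸ m)))

  linear : ℕ → UPoly
  linear m = pneg (bsum (suc m)) ∷ pone ∷ []

  sigma-linear : ∀ m p → umul (sigma p) (linear m) ≈ᵤ uadd (sigma (suc p)) (uscale (bdiff m p) (sigma p))
  sigma-linear m p = begin
    umul σ (linear m)                                   ≈⟨ umul-linear σ (pneg a) ⟩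
    uadd (pzero ∷ σ) (uscale (pneg a) σ)                ≈⟨ uadd-congˡ (pzero ∷ σ) (uscale-congʳ σ coefficient) ⟩
    uadd (pzero ∷ σ) (uscale (pneg b ++ w) σ)           ≈⟨ uadd-congˡ (pzero ∷ σ) (uscale-distribʳ (pneg b) w σ) ⟩
    uadd (pzero ∷ σ) (uadd (uscale (pneg b) σ) (uscale w σ))
                                                        ≈⟨ uadd-assoc (pzero ∷ σ) (uscale (pneg b) σ) (uscale w σ) ⟨
    uadd (uadd (pzero ∷ σ) (uscale (pneg b) σ)) (uscale w σ)
                                                        ≈⟨ uadd-congʳ (uscale w σ) (sigma-suc p) ⟨
    uadd (sigma (suc p)) (uscale w σ)                   ∎
    where
    open ≈ᵤ-Reasoning
    σ = sigma p
    a = bsum (suc m)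
    b = bsum (suc p)
    w = bdiff m p
    coefficient : pneg a ≈ pneg b ++ (b ++ pneg a)
    coefficient = solve 2 (λ a b → :- a := (:- b) :+ (b :+ (:- a))) ≈-refl a b

  uscale-sigma-linear : ∀ m p c → umul (uscale c (sigma p)) (linear m) ≈ᵤ
                                  uadd (uscale (pmul c (bdiff m p)) (sigma p)) (uscale c (sigma (suc p)))
  uscale-sigma-linear m p c = begin
    umul (uscale c σ) (linear m)                  ≈⟨ umul-uscaleˡ c σ (linear m) ⟩
    uscale c (umul σ (linear m))                  ≈⟨ uscale-congˡ c (sigma-linear m p) ⟩
    uscale c (uadd σ′ (uscale w σ))               ≈⟨ uscale-distribˡ c σ′ (uscale w σ) ⟩
    uadd (uscale c σ′) (uscale c (uscale w σ))    ≈⟨ uadd-comm (uscale c σ′) (uscale c (uscale w σ)) ⟩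
    uadd (uscale c (uscale w σ)) (uscale c σ′)    ≈⟨ uadd-congʳ (uscale c σ′) (uscale-assoc c w σ) ⟨
    uadd (uscale (pmul c w) σ) (uscale c σ′)      ∎
    where
    open ≈ᵤ-Reasoning
    σ = sigma p
    σ′ = sigma (suc p)
    w = bdiff m p

  -- By sigma-linear, the σ_p-coefficient of (Σ_q c_q σ_q)(u - b_{m+1}) is c_{p-1} + c_p (b_{p+1} - b_{m+1}).
  linearCoeffs : ℕ → (ℕ → Poly) → ℕ → Poly
  linearCoeffs m c zero    = pmul (c 0) (bdiff m 0)
  linearCoeffs m c (suc p) = c p ++ pmul (c (suc p)) (bdiff m (suc p))

  σ-sum-linear : ∀ m D c → umul (σ-sum D c) (linear m) ≈ᵤ
                           uadd (σ-sum D (linearCoeffs m c)) (uscale (c D) (sigma (suc D)))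
  σ-sum-linear m zero    c = uscale-sigma-linear m 0 (c 0)
  σ-sum-linear m (suc D) c = begin
    umul (uadd (σ-sum D c) (uscale c₁ σ₁)) (linear m)
      ≈⟨ umul-uaddˡ (σ-sum D c) (uscale c₁ σ₁) (linear m) ⟩
    uadd (umul (σ-sum D c) (linear m)) (umul (uscale c₁ σ₁) (linear m))
      ≈⟨ uadd-cong (σ-sum-linear m D c) (uscale-sigma-linear m (suc D) c₁) ⟩
    uadd (uadd S (uscale c₀ σ₁)) (uadd (uscale (pmul c₁ w) σ₁) (uscale c₁ σ₂))
      ≈⟨ uadd-assoc (uadd S (uscale c₀ σ₁)) (uscale (pmul c₁ w) σ₁) (uscale c₁ σ₂) ⟨
    uadd (uadd (uadd S (uscale c₀ σ₁)) (uscale (pmul c₁ w) σ₁)) (uscale c₁ σ₂)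
      ≈⟨ uadd-congʳ (uscale c₁ σ₂) (uadd-assoc S (uscale c₀ σ₁) (uscale (pmul c₁ w) σ₁)) ⟩
    uadd (uadd S (uadd (uscale c₀ σ₁) (uscale (pmul c₁ w) σ₁))) (uscale c₁ σ₂)
      ≈⟨ uadd-congʳ (uscale c₁ σ₂) (uadd-congˡ S (uscale-distribʳ c₀ (pmul c₁ w) σ₁)) ⟨
    uadd (uadd S (uscale (c₀ ++ pmul c₁ w) σ₁)) (uscale c₁ σ₂)
      ∎
    where
    open ≈ᵤ-Reasoning
    S = σ-sum D (linearCoeffs m c)
    c₀ = c D
    c₁ = c (suc D)
    w = bdiff m (suc D)
    σ₁ = sigma (suc D)
    σ₂ = sigma (suc (suc D))

  -- For m ≤ j, C-monomials j m p lists the monomials of C^p_{m,j}, with multiplicity: multiplying σ_j by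
  -- the factors u - b_1, …, u - b_m of σ_m one at a time, sigma-linear only ever contributes
  -- b_{p+1} - b_{l+1} = β_{l+1} + ⋯ + β_p with l ≤ p, so no cancellation occurs.
  C-monomials : ℕ → ℕ → ℕ → List Mono
  C-monomials j zero    p with p ≟ j
  ... | yes _ = [] ∷ []
  ... | no  _ = []
  C-monomials j (suc m) zero    = []
  C-monomials j (suc m) (suc p) =
    C-monomials j m p ++
    cartesianProductWith addMono (C-monomials j m (suc p)) (map unitMono (interval m (suc p ∸ m)))

  C-monomials-below : ∀ j m {p} → p < j → C-monomials j m p ≡ []
  C-monomials-below j zero    {p}     p<j with p ≟ j
  ... | yes refl = ⊥-elim (<-irrefl refl p<j)
  ... | no  _    = refl
  C-monomials-below j (suc m) {zero}  p<j = refl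
  C-monomials-below j (suc m) {suc p} p<j
    rewrite C-monomials-below j m (<-trans (n<1+n p) p<j) | C-monomials-below j m p<j = refl

  C-monomials-above : ∀ j m {p} → m + j < p → C-monomials j m p ≡ []
  C-monomials-above j zero    {p}     j<p with p ≟ j
  ... | yes refl = ⊥-elim (<-irrefl refl j<p)
  ... | no  _    = refl
  C-monomials-above j (suc m) {suc p} (s≤s m+j<p)
    rewrite C-monomials-above j m m+j<p | C-monomials-above j m (m<n⇒m<1+n m+j<p) = refl

  C-monomials-zero-top : ∀ j → toPoly (C-monomials j zero j) ≡ pone
  C-monomials-zero-top j with j ≟ j
  ... | yes _   = refl
  ... | no  j≢j = ⊥-elim (j≢j refl)

  linearCoeffs-C-monomials : ∀ {j m} → suc m ≤ j → ∀ p →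
    linearCoeffs m (toPoly ∘ C-monomials j m) p ≈ toPoly (C-monomials j (suc m) p)
  linearCoeffs-C-monomials {j} {m} m<j zero rewrite C-monomials-below j m (<-≤-trans (s≤s z≤n) m<j) = ≈-refl
  linearCoeffs-C-monomials {j} {m} m<j (suc p) = begin
    toPoly (A p) ++ pmul (toPoly (A (suc p))) (bdiff m (suc p))
      ≈⟨ ++-congˡ (toPoly (A p)) positive ⟩
    toPoly (A p) ++ pmul (toPoly (A (suc p))) (toPoly I)
      ≡⟨ cong (toPoly (A p) ++_) (toPoly-cartesianProductWith (A (suc p)) I) ⟨
    toPoly (A p) ++ toPoly (cartesianProductWith addMono (A (suc p)) I)
      ≡⟨ List.map-++ _ (A p) _ ⟨
    toPoly (C-monomials j (suc m) (suc p))
      ∎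
    where
    open ≈-Reasoning
    A = C-monomials j m
    I = map unitMono (interval m (suc p ∸ m))
    positive : pmul (toPoly (A (suc p))) (bdiff m (suc p)) ≈ pmul (toPoly (A (suc p))) (toPoly I)
    positive with suc p <? j
    ... | yes p<j rewrite C-monomials-below j m p<j = ≈-refl
    ... | no  p≮j = pmul-congˡ (toPoly (A (suc p))) (bdiff-interval (≤-trans (<⇒≤ m<j) (≮⇒≥ p≮j)))

  σ-product : ∀ j m → m ≤ j → umul (sigma m) (sigma j) ≈ᵤ σ-sum (m + j) (toPoly ∘ C-monomials j m)
  σ-product j zero    _   =
    ≈ᵤ-trans (umul-comm (pone ∷ []) (sigma j)) (≈ᵤ-trans (umul-identityʳ (sigma j))
      (≈ᵤ-sym (σ-sum-sigma j (λ p p<j → ≈-reflexive (cong toPoly (C-monomials-below j 0 p<j)))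
                             (≈-reflexive (C-monomials-zero-top j)))))
  σ-product j (suc m) m<j = begin
    umul (umul (sigma m) (linear m)) (sigma j)
      ≈⟨ umul-assoc (sigma m) (linear m) (sigma j) ⟩
    umul (sigma m) (umul (linear m) (sigma j))
      ≈⟨ umul-congˡ (sigma m) (umul-comm (linear m) (sigma j)) ⟩
    umul (sigma m) (umul (sigma j) (linear m))
      ≈⟨ umul-assoc (sigma m) (sigma j) (linear m) ⟨
    umul (umul (sigma m) (sigma j)) (linear m)
      ≈⟨ umul-congʳ (linear m) (σ-product j m (<⇒≤ m<j)) ⟩
    umul (σ-sum (m + j) c) (linear m)
      ≈⟨ σ-sum-linear m (m + j) c ⟩
    uadd (σ-sum (m + j) (linearCoeffs m c)) (uscale (c (m + j)) (sigma (suc (m + j))))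
      ≈⟨ uadd-cong (σ-sum-cong (m + j) (λ p _ → linearCoeffs-C-monomials m<j p))
                   (uscale-congʳ (sigma (suc (m + j))) top) ⟩
    σ-sum (suc m + j) (toPoly ∘ C-monomials j (suc m))
      ∎
    where
    open ≈ᵤ-Reasoning
    c = toPoly ∘ C-monomials j m
    top : c (m + j) ≈ toPoly (C-monomials j (suc m) (suc (m + j)))
    top rewrite C-monomials-above j m (n<1+n (m + j)) = ≈-reflexive (cong toPoly (sym (List.++-identityʳ _)))

  C-from-σ-sum : ∀ i j {c} → umul (sigma i) (sigma j) ≈ᵤ σ-sum (i + j) c →
                 (∀ {k} → i + j < k → c k ≈ pzero) → ∀ k → C k i j ≈ c k
  C-from-σ-sum i j σσ≈ c-vanishes k with k ≤? i + j
  ... | yes k≤i+j = expand-σ-sum (i + j) σσ≈ k≤i+j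
  ... | no  k≰i+j = ≈-trans (≈-reflexive (expand-above (i + j) _ i+j<k)) (≈-sym (c-vanishes i+j<k))
    where i+j<k = ≰⇒> k≰i+j

  C-positive : ∀ {i j} → i ≤ j → ∀ k → C k i j ≈ toPoly (C-monomials j i k)
  C-positive {i} {j} i≤j = C-from-σ-sum i j (σ-product j i i≤j)
    (λ i+j<k → ≈-reflexive (cong toPoly (C-monomials-above j i i+j<k)))

  C-positive′ : ∀ {i j} → j ≤ i → ∀ k → C k i j ≈ toPoly (C-monomials i j k)
  C-positive′ {i} {j} j≤i = C-from-σ-sum i j σσ≈
    (λ {k} i+j<k → ≈-reflexive (cong toPoly (C-monomials-above i j (subst (_< k) (+-comm i j) i+j<k))))
    where
    σσ≈ : umul (sigma i) (sigma j) ≈ᵤ σ-sum (i + j) (toPoly ∘ C-monomials i j)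
    σσ≈ = ≈ᵤ-trans (umul-comm (sigma i) (sigma j))
            (subst (λ d → umul (sigma j) (sigma i) ≈ᵤ σ-sum d (toPoly ∘ C-monomials i j)) (+-comm j i)
                   (σ-product i j j≤i))

open StructureConstants

module PrefixSums where

  open import Data.Empty using (⊥-elim)
  open import Data.Nat using (ℕ; zero; suc; _+_; _*_; _∸_; _≤_; _<_; z≤n; _<?_)
  open import Data.Nat.Properties
  open import Data.Nat.Tactic.RingSolver using (solve-∀)
  open import Data.Product using (∃; _×_; _,_)
  open import Data.Sum using (inj₁; inj₂)
  open import Relation.Binary.PropositionalEquality
  open import Relation.Nullary using (yes; no)

  sumBelow-cong : ∀ t {f g} → (∀ l → l < t → f l ≡ g l) → sumBelow t f ≡ sumBelow t g
  sumBelow-cong zero    f≗g = refl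
  sumBelow-cong (suc t) f≗g =
    cong₂ _+_ (sumBelow-cong t (λ l l<t → f≗g l (m<n⇒m<1+n l<t))) (f≗g t ≤-refl)

  sumBelow-zero : ∀ t {f} → (∀ l → l < t → f l ≡ 0) → sumBelow t f ≡ 0
  sumBelow-zero zero    f≗0 = refl
  sumBelow-zero (suc t) f≗0 =
    cong₂ _+_ (sumBelow-zero t (λ l l<t → f≗0 l (m<n⇒m<1+n l<t))) (f≗0 t ≤-refl)

  sumBelow-+ : ∀ t f g → sumBelow t (λ l → f l + g l) ≡ sumBelow t f + sumBelow t g
  sumBelow-+ zero    f g = refl
  sumBelow-+ (suc t) f g rewrite sumBelow-+ t f g = swap (sumBelow t f) (sumBelow t g) (f t) (g t)
    where
    swap : ∀ a b c d → (a + b) + (c + d) ≡ (a + c) + (b + d)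
    swap = solve-∀

  sumBelow-mono : ∀ t {f g} → (∀ l → f l ≤ g l) → sumBelow t f ≤ sumBelow t g
  sumBelow-mono zero    f≤g = z≤n
  sumBelow-mono (suc t) f≤g = +-mono-≤ (sumBelow-mono t f≤g) (f≤g t)

  sumBelow-∸ : ∀ t f g → (∀ l → g l ≤ f l) →
               sumBelow t (λ l → f l ∸ g l) ≡ sumBelow t f ∸ sumBelow t g
  sumBelow-∸ zero    f g g≤f = refl
  sumBelow-∸ (suc t) f g g≤f = begin
    sumBelow t (λ l → f l ∸ g l) + (f t ∸ g t)
      ≡⟨ cong (_+ (f t ∸ g t)) (sumBelow-∸ t f g g≤f) ⟩
    (sumBelow t f ∸ sumBelow t g) + (f t ∸ g t)
      ≡⟨ +-∸-comm (f t ∸ g t) (sumBelow-mono t g≤f) ⟨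
    (sumBelow t f + (f t ∸ g t)) ∸ sumBelow t g
      ≡⟨ cong (_∸ sumBelow t g) (+-∸-assoc (sumBelow t f) (g≤f t)) ⟨
    (sumBelow t f + f t ∸ g t) ∸ sumBelow t g
      ≡⟨ ∸-+-assoc (sumBelow t f + f t) (g t) _ ⟩
    sumBelow t f + f t ∸ (g t + sumBelow t g)
      ≡⟨ cong (sumBelow t f + f t ∸_) (+-comm (g t) _) ⟩
    sumBelow t f + f t ∸ (sumBelow t g + g t)
      ∎
    where open ≡-Reasoning

  sumBelow-monoˡ : ∀ f {s t} → s ≤ t → sumBelow s f ≤ sumBelow t f
  sumBelow-monoˡ f {s} {zero}  z≤n = z≤n
  sumBelow-monoˡ f {s} {suc t} s≤t with m≤n⇒m<n∨m≡n s≤t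
  ... | inj₁ s<t  = ≤-trans (sumBelow-monoˡ f (≤-pred s<t)) (m≤m+n _ _)
  ... | inj₂ refl = ≤-refl

  sumBelow-+-split : ∀ f a b → sumBelow (a + b) f ≡ sumBelow a f + sumBelow b (λ r → f (a + r))
  sumBelow-+-split f a zero    = trans (cong (λ t → sumBelow t f) (+-identityʳ a)) (sym (+-identityʳ _))
  sumBelow-+-split f a (suc b) = trans (cong (λ t → sumBelow t f) (+-suc a b))
    (trans (cong (_+ f (a + b)) (sumBelow-+-split f a b)) (+-assoc (sumBelow a f) _ _))

  sumBelow-vanishing : ∀ f {k} → (∀ l → k ≤ l → f l ≡ 0) →
                       ∀ {t} → k ≤ t → sumBelow t f ≡ sumBelow k f
  sumBelow-vanishing f f≗0 {zero}  z≤n = refl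
  sumBelow-vanishing f f≗0 {suc t} k≤t with m≤n⇒m<n∨m≡n k≤t
  ... | inj₁ k<t  =
    trans (cong₂ _+_ (sumBelow-vanishing f f≗0 (≤-pred k<t)) (f≗0 t (≤-pred k<t))) (+-identityʳ _)
  ... | inj₂ refl = refl

  sumBelow≤total : ∀ f {k} → (∀ l → k ≤ l → f l ≡ 0) → ∀ t → sumBelow t f ≤ sumBelow k f
  sumBelow≤total f {k} f≗0 t with ≤-total t k
  ... | inj₁ t≤k = sumBelow-monoˡ f t≤k
  ... | inj₂ k≤t = ≤-reflexive (sumBelow-vanishing f f≗0 k≤t)

  sumBelow≡0⇒ : ∀ f {k} → sumBelow k f ≡ 0 → ∀ {l} → l < k → f l ≡ 0
  sumBelow≡0⇒ f {suc k} Σ≡0 {l} l<k with m≤n⇒m<n∨m≡n (≤-pred l<k)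
  ... | inj₁ l<k′ = sumBelow≡0⇒ f (m+n≡0⇒m≡0 _ Σ≡0) l<k′
  ... | inj₂ refl = m+n≡0⇒n≡0 (sumBelow k f) Σ≡0

  sumBelow-<⇒positive : ∀ f {s t} → sumBelow s f < sumBelow t f → ∃ λ l → s ≤ l × l < t × 0 < f l
  sumBelow-<⇒positive f {s} {zero}  Σ<Σ = ⊥-elim (n≮0 Σ<Σ)
  sumBelow-<⇒positive f {s} {suc t} Σ<Σ with 0 <? f t
  ... | yes ft>0 with s ≤? t
  ...   | yes s≤t = t , s≤t , ≤-refl , ft>0
  ...   | no  s≰t = ⊥-elim (<-irrefl refl (<-≤-trans Σ<Σ (sumBelow-monoˡ f (≰⇒> s≰t))))
  sumBelow-<⇒positive f {s} {suc t} Σ<Σ | no ft≯0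
    with sumBelow-<⇒positive f (subst (sumBelow s f <_) (trans (cong (sumBelow t f +_) (n≤0⇒n≡0 (≮⇒≥ ft≯0)))
                                                              (+-identityʳ _)) Σ<Σ)
  ... | l , s≤l , l<t , fl>0 = l , s≤l , m<n⇒m<1+n l<t , fl>0

  sumBelow-telescope : ∀ (h : ℕ → ℕ) t → (∀ l → h l ≤ h (suc l)) →
                       sumBelow t (λ l → h (suc l) ∸ h l) ≡ h t ∸ h 0
  sumBelow-telescope h zero    h-mono = sym (n∸n≡0 (h 0))
  sumBelow-telescope h (suc t) h-mono = begin
    sumBelow t (λ l → h (suc l) ∸ h l) + (h (suc t) ∸ h t)
      ≡⟨ cong (_+ (h (suc t) ∸ h t)) (sumBelow-telescope h t h-mono) ⟩
    (h t ∸ h 0) + (h (suc t) ∸ h t)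
      ≡⟨ +-∸-comm (h (suc t) ∸ h t) (h0≤h t) ⟨
    (h t + (h (suc t) ∸ h t)) ∸ h 0
      ≡⟨ cong (_∸ h 0) (m+[n∸m]≡n (h-mono t)) ⟩
    h (suc t) ∸ h 0
      ∎
    where
    open ≡-Reasoning
    h0≤h : ∀ t → h 0 ≤ h t
    h0≤h zero    = ≤-refl
    h0≤h (suc t) = ≤-trans (h0≤h t) (h-mono t)

  sumBelow-blocks : ∀ N f g → (∀ q → sumBelow N (λ r → f (q * N + r)) ≡ g q) →
                    ∀ t → sumBelow t g ≡ sumBelow (t * N) f
  sumBelow-blocks N f g blocks zero    = refl
  sumBelow-blocks N f g blocks (suc t) = begin
    sumBelow t g + g t
      ≡⟨ cong₂ _+_ (sumBelow-blocks N f g blocks t) (sym (blocks t)) ⟩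
    sumBelow (t * N) f + sumBelow N (λ r → f (t * N + r))
      ≡⟨ sumBelow-+-split f (t * N) N ⟨
    sumBelow (t * N + N) f
      ≡⟨ cong (λ s → sumBelow s f) (+-comm (t * N) N) ⟩
    sumBelow (suc t * N) f
      ∎
    where open ≡-Reasoning

open PrefixSums

module LatticePoints where

  open Monomials
  open PrefixSums
  open import Data.List using ([]; _∷_; _++_; applyUpTo; replicate)
  open import Data.Nat using (ℕ; zero; suc; _+_; _*_; _∸_; _≤_; _<_; z≤n; s≤s; _<?_; _/_; _%_)
  open import Data.Nat.DivMod using (m≡m%n+[m/n]*n; m%n<n)
  open import Data.Nat.Properties
  open import Data.Nat.Tactic.RingSolver using (solve-∀)
  open import Data.Product using (∃₂; _×_; _,_)
  open import Data.Sum using (inj₁; inj₂)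
  open import Function using (_∘_)
  open import Relation.Binary.PropositionalEquality
  open import Relation.Nullary using (yes; no)

  sumBelow-unitMono-≤ : ∀ {l t} → t ≤ l → sumBelow t (get (unitMono l)) ≡ 0
  sumBelow-unitMono-≤ {l} {t} t≤l =
    sumBelow-zero t (λ i i<t → get-unitMono-other (<⇒≢ (<-≤-trans i<t t≤l)))

  sumBelow-unitMono-> : ∀ {l t} → l < t → sumBelow t (get (unitMono l)) ≡ 1
  sumBelow-unitMono-> {l} {suc t} l<t with m≤n⇒m<n∨m≡n (≤-pred l<t)
  ... | inj₁ l<t′ = cong₂ _+_ (sumBelow-unitMono-> l<t′) (get-unitMono-other (<⇒≢ l<t′ ∘ sym))
  ... | inj₂ refl = cong₂ _+_ (sumBelow-unitMono-≤ {l} ≤-refl) (get-unitMono-same l)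

  -- y is a lattice point of N·P(d, k), where P(d, k) is the polytope of the x ∈ ℝ^k with x ≥ 0,
  -- Σ_l x_l = d and Σ_{l<t} x_l ≤ t for every t.
  record LatticePoint (N d k : ℕ) (y : Mono) : Set where
    field
      vanishes : ∀ l → k ≤ l → get y l ≡ 0
      total    : sumBelow k (get y) ≡ N * d
      prefix   : ∀ t → sumBelow t (get y) ≤ N * t

  open LatticePoint public

  LatticePoint-resp-≋ : ∀ {N d k y z} → y ≋ z → LatticePoint N d k y → LatticePoint N d k z
  LatticePoint-resp-≋ {k = k} {y} {z} y≋z p = record
    { vanishes = λ l k≤l → trans (sym (get-≡ y≋z l)) (vanishes p l k≤l)
    ; total    = trans (sumBelow-cong k (λ l _ → sym (get-≡ y≋z l))) (total p)
    ; prefix   = λ t → subst (_≤ _) (sumBelow-cong t (λ l _ → get-≡ y≋z l)) (prefix p t)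
    }

  LatticePoint-[] : ∀ {N d k y} → y ≋ [] → N * d ≡ 0 → LatticePoint N d k y
  LatticePoint-[] {N} {k = k} y≋[] Nd≡0 = record
    { vanishes = λ l _ → get-≡ y≋[] l
    ; total    = trans (sumBelow-zero k (λ l _ → get-≡ y≋[] l)) (sym Nd≡0)
    ; prefix   = λ t → ≤-trans (≤-reflexive (sumBelow-zero t (λ l _ → get-≡ y≋[] l))) z≤n
    }

  LatticePoint-+ : ∀ {a b d k y z} → LatticePoint a d k y → LatticePoint b d k z →
                   LatticePoint (a + b) d k (addMono y z)
  LatticePoint-+ {a} {b} {d} {k} {y} {z} p q = record
    { vanishes = λ l k≤l → trans (get-addMono y z l) (cong₂ _+_ (vanishes p l k≤l) (vanishes q l k≤l))
    ; total    = trans (sum≡ k) (trans (cong₂ _+_ (total p) (total q)) (sym (*-distribʳ-+ d a b)))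
    ; prefix   = λ t → subst (_≤ (a + b) * t) (sym (sum≡ t))
                         (subst (sumBelow t (get y) + sumBelow t (get z) ≤_) (sym (*-distribʳ-+ t a b))
                            (+-mono-≤ (prefix p t) (prefix q t)))
    }
    where
    sum≡ : ∀ t → sumBelow t (get (addMono y z)) ≡ sumBelow t (get y) + sumBelow t (get z)
    sum≡ t = trans (sumBelow-cong t (λ l _ → get-addMono y z l)) (sumBelow-+ t (get y) (get z))

  module _ {d k : ℕ} {e : Mono} where

    prefix₁ : LatticePoint 1 d k e → ∀ t → sumBelow t (get e) ≤ t
    prefix₁ p t = subst (sumBelow t (get e) ≤_) (*-identityˡ t) (prefix p t)

    total₁ : LatticePoint 1 d k e → sumBelow k (get e) ≡ d
    total₁ p = trans (total p) (*-identityˡ d)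

    latticePoint₁ : (∀ l → k ≤ l → get e l ≡ 0) → sumBelow k (get e) ≡ d →
                    (∀ t → sumBelow t (get e) ≤ t) → LatticePoint 1 d k e
    latticePoint₁ vanishes total prefix = record
      { vanishes = vanishes
      ; total    = trans total (sym (*-identityˡ d))
      ; prefix   = λ t → subst (sumBelow t (get e) ≤_) (sym (*-identityˡ t)) (prefix t)
      }

  LatticePoint-extend : ∀ {N d k e} → LatticePoint N d k e → LatticePoint N d (suc k) e
  LatticePoint-extend {k = k} {e} p = record
    { vanishes = λ l k<l → vanishes p l (<⇒≤ k<l)
    ; total    = trans (cong (sumBelow k (get e) +_) (vanishes p k ≤-refl)) (trans (+-identityʳ _) (total p))
    ; prefix   = prefix p
    }

  LatticePoint-shrink : ∀ {N d k e} → LatticePoint N d (suc k) e → get e k ≡ 0 → LatticePoint N d k e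
  LatticePoint-shrink {k = k} {e} p eₖ≡0 = record
    { vanishes = λ l k≤l → case-≤ k≤l
    ; total    = trans (sym (trans (cong (sumBelow k (get e) +_) eₖ≡0) (+-identityʳ _))) (total p)
    ; prefix   = prefix p
    }
    where
    case-≤ : ∀ {l} → k ≤ l → get e l ≡ 0
    case-≤ {l} k≤l with m≤n⇒m<n∨m≡n k≤l
    ... | inj₁ k<l  = vanishes p l k<l
    ... | inj₂ refl = eₖ≡0

  LatticePoint-null : ∀ {N d k e} → LatticePoint N d k e → N * d ≡ 0 → e ≋ []
  LatticePoint-null {N} {d} {k} {e} p Nd≡0 = mk≋ entry
    where
    entry : ∀ l → get e l ≡ 0
    entry l with l <? k
    ... | yes l<k = sumBelow≡0⇒ (get e) (trans (total p) Nd≡0) l<k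
    ... | no  l≮k = vanishes p l (≮⇒≥ l≮k)

  LatticePoint-addUnit : ∀ {d k L l} → LatticePoint 1 d k L → d ≤ l → l < k →
                         LatticePoint 1 (suc d) k (addMono L (unitMono l))
  LatticePoint-addUnit {d} {k} {L} {l} p d≤l l<k = latticePoint₁
    (λ i k≤i → trans (get-addMono L (unitMono l) i)
                 (cong₂ _+_ (vanishes p i k≤i) (get-unitMono-other (λ i≡l → <⇒≱ l<k (subst (k ≤_) i≡l k≤i)))))
    (trans (sum≡ k) (trans (cong₂ _+_ (total₁ p) (sumBelow-unitMono-> l<k)) (+-comm d 1)))
    prefix′
    where
    sum≡ : ∀ t → sumBelow t (get (addMono L (unitMono l))) ≡ sumBelow t (get L) + sumBelow t (get (unitMono l))
    sum≡ t = trans (sumBelow-cong t (λ i _ → get-addMono L (unitMono l) i))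
                   (sumBelow-+ t (get L) (get (unitMono l)))
    -- Past l the unit adds 1, and Σ_{i<t} L_i ≤ d ≤ l < t leaves room for it.
    prefix′ : ∀ t → sumBelow t (get (addMono L (unitMono l))) ≤ t
    prefix′ t with l <? t
    ... | yes l<t = begin
      sumBelow t (get (addMono L (unitMono l)))
        ≡⟨ sum≡ t ⟩
      sumBelow t (get L) + sumBelow t (get (unitMono l))
        ≡⟨ cong (sumBelow t (get L) +_) (sumBelow-unitMono-> l<t) ⟩
      sumBelow t (get L) + 1
        ≤⟨ +-monoˡ-≤ 1 (sumBelow≤total (get L) (vanishes p) t) ⟩
      sumBelow k (get L) + 1
        ≡⟨ cong (_+ 1) (total₁ p) ⟩
      d + 1
        ≤⟨ +-monoˡ-≤ 1 d≤l ⟩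
      l + 1
        ≡⟨ +-comm l 1 ⟩
      suc l
        ≤⟨ l<t ⟩
      t
        ∎
      where open ≤-Reasoning
    ... | no  l≮t = begin
      sumBelow t (get (addMono L (unitMono l)))
        ≡⟨ sum≡ t ⟩
      sumBelow t (get L) + sumBelow t (get (unitMono l))
        ≡⟨ cong (sumBelow t (get L) +_) (sumBelow-unitMono-≤ (≮⇒≥ l≮t)) ⟩
      sumBelow t (get L) + 0
        ≡⟨ +-identityʳ _ ⟩
      sumBelow t (get L)
        ≤⟨ prefix₁ p t ⟩
      t
        ∎
      where open ≤-Reasoning

  LatticePoint-removeUnit : ∀ {d k e l} → LatticePoint 1 (suc d) k e → 0 < get e l → l < k →
                            LatticePoint 1 d k (subMono e (unitMono l))
  LatticePoint-removeUnit {d} {k} {e} {l} p eₗ>0 l<k = latticePoint₁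
    (λ i k≤i → trans (get-subMono e (unitMono l) i)
                 (trans (cong (_∸ get (unitMono l) i) (vanishes p i k≤i)) (0∸n≡0 (get (unitMono l) i))))
    (trans (sum≡ k) (cong₂ _∸_ (total₁ p) (sumBelow-unitMono-> l<k)))
    (λ t → ≤-trans (≤-reflexive (sum≡ t)) (≤-trans (m∸n≤m _ (sumBelow t (get (unitMono l)))) (prefix₁ p t)))
    where
    sum≡ : ∀ t → sumBelow t (get (subMono e (unitMono l))) ≡
                 sumBelow t (get e) ∸ sumBelow t (get (unitMono l))
    sum≡ t = trans (sumBelow-cong t (λ i _ → get-subMono e (unitMono l) i))
                   (sumBelow-∸ t (get e) (get (unitMono l)) (unitMono≤ {e} eₗ>0))

  module Ceiling (n : ℕ) where

    private
      N = suc n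

    ⌈_/N⌉ : ℕ → ℕ
    ⌈ a /N⌉ = (a + n) / N

    ⌈/N⌉-lower : ∀ a → a ≤ N * ⌈ a /N⌉
    ⌈/N⌉-lower a = +-cancelʳ-≤ n a (N * ⌈ a /N⌉) (begin
      a + n                              ≡⟨ m≡m%n+[m/n]*n (a + n) N ⟩
      (a + n) % N + ⌈ a /N⌉ * N          ≤⟨ +-monoˡ-≤ _ (≤-pred (m%n<n (a + n) N)) ⟩
      n + ⌈ a /N⌉ * N                    ≡⟨ cong₂ _+_ refl (*-comm ⌈ a /N⌉ N) ⟩
      n + N * ⌈ a /N⌉                    ≡⟨ +-comm n _ ⟩
      N * ⌈ a /N⌉ + n                    ∎)
      where open ≤-Reasoning

    ⌈/N⌉-upper : ∀ a → N * ⌈ a /N⌉ ≤ a + n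
    ⌈/N⌉-upper a = begin
      N * ⌈ a /N⌉                        ≡⟨ *-comm N ⌈ a /N⌉ ⟩
      ⌈ a /N⌉ * N                        ≤⟨ m≤n+m _ ((a + n) % N) ⟩
      (a + n) % N + ⌈ a /N⌉ * N          ≡⟨ m≡m%n+[m/n]*n (a + n) N ⟨
      a + n                              ∎
      where open ≤-Reasoning

    ≤-by-multiples : ∀ {x y z} → N * x ≤ y + n → y ≤ N * z → x ≤ z
    ≤-by-multiples {x} {y} {z} Nx≤y+n y≤Nz = ≤-pred (*-cancelˡ-< N x (suc z) (begin-strict
      N * x          ≤⟨ Nx≤y+n ⟩
      y + n          ≤⟨ +-monoˡ-≤ n y≤Nz ⟩
      N * z + n      <⟨ +-monoʳ-< (N * z) ≤-refl ⟩
      N * z + N      ≡⟨ +-comm (N * z) N ⟩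
      N + N * z      ≡⟨ *-suc N z ⟨
      N * suc z      ∎))
      where open ≤-Reasoning

    ⌈/N⌉-least : ∀ {a t} → a ≤ N * t → ⌈ a /N⌉ ≤ t
    ⌈/N⌉-least {a} = ≤-by-multiples (⌈/N⌉-upper a)

    ⌈/N⌉-mono : ∀ {a b} → a ≤ b → ⌈ a /N⌉ ≤ ⌈ b /N⌉
    ⌈/N⌉-mono {a} {b} a≤b = ≤-by-multiples (≤-trans (⌈/N⌉-upper a) (+-monoˡ-≤ n a≤b)) (⌈/N⌉-lower b)

    ⌈/N⌉-+ : ∀ a b → ⌈ a + b /N⌉ ≤ ⌈ a /N⌉ + b
    ⌈/N⌉-+ a b = ⌈/N⌉-least (begin
      a + b                          ≤⟨ +-mono-≤ (⌈/N⌉-lower a) (m≤n*m b N) ⟩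
      N * ⌈ a /N⌉ + N * b            ≡⟨ *-distribˡ-+ N ⌈ a /N⌉ b ⟨
      N * (⌈ a /N⌉ + b)              ∎)
      where open ≤-Reasoning

    ⌈/N⌉-multiple : ∀ d → ⌈ N * d /N⌉ ≡ d
    ⌈/N⌉-multiple d = ≤-antisym (⌈/N⌉-least ≤-refl) (*-cancelˡ-≤ N (⌈/N⌉-lower (N * d)))

    ∸⌈/N⌉ : ∀ {a t} → a ≤ N * t → a ∸ ⌈ a /N⌉ ≤ n * t
    ∸⌈/N⌉ {a} {t} a≤Nt =
      m≤n+o⇒m∸n≤o a ⌈ a /N⌉ (≤-trans (⌈/N⌉-lower a) (+-monoʳ-≤ ⌈ a /N⌉ (*-monoʳ-≤ n (⌈/N⌉-least a≤Nt))))

  prefixDifferences : ℕ → (ℕ → ℕ) → Mono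
  prefixDifferences k H = applyUpTo (λ l → H (suc l) ∸ H l) k

  module _ (k : ℕ) (H : ℕ → ℕ) (H-stable : ∀ l → k ≤ l → H (suc l) ≡ H l) where

    get-prefixDifferences : ∀ l → get (prefixDifferences k H) l ≡ H (suc l) ∸ H l
    get-prefixDifferences l with l <? k
    ... | yes l<k = get-applyUpTo-< k _ l<k
    ... | no  l≮k = trans (get-applyUpTo-≥ k _ (≮⇒≥ l≮k))
                          (sym (trans (cong (_∸ H l) (H-stable l (≮⇒≥ l≮k))) (n∸n≡0 (H l))))

    sumBelow-prefixDifferences : (∀ l → H l ≤ H (suc l)) → H 0 ≡ 0 →
                                 ∀ t → sumBelow t (get (prefixDifferences k H)) ≡ H t
    sumBelow-prefixDifferences H-mono H0≡0 t = begin
      sumBelow t (get (prefixDifferences k H))   ≡⟨ sumBelow-cong t (λ l _ → get-prefixDifferences l) ⟩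
      sumBelow t (λ l → H (suc l) ∸ H l)         ≡⟨ sumBelow-telescope H t H-mono ⟩
      H t ∸ H 0                                  ≡⟨ cong (H t ∸_) H0≡0 ⟩
      H t                                        ∎
      where open ≡-Reasoning

  -- Take for e the point whose prefix sums are ⌈Y(t)/(n+1)⌉, Y(t) being those of y: rounding up keeps
  -- e ≤ y entrywise, and Y(t) - ⌈Y(t)/(n+1)⌉ ≤ n t.
  LatticePoint-split : ∀ n {d k y} → LatticePoint (suc n) d k y →
                       ∃₂ λ e z → LatticePoint 1 d k e × LatticePoint n d k z × y ≋ addMono e z
  LatticePoint-split n {d} {k} {y} p = e , z , e-point , z-point , y≋e+z
    where
    open Ceiling n
    Y : ℕ → ℕ
    Y t = sumBelow t (get y)
    E : ℕ → ℕ
    E t = ⌈ Y t /N⌉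
    E-stable : ∀ l → k ≤ l → E (suc l) ≡ E l
    E-stable l k≤l = cong ⌈_/N⌉ (trans (cong (Y l +_) (vanishes p l k≤l)) (+-identityʳ (Y l)))
    E-total : E k ≡ d
    E-total = trans (cong ⌈_/N⌉ (total p)) (⌈/N⌉-multiple d)

    e = prefixDifferences k E
    E-sum : ∀ t → sumBelow t (get e) ≡ E t
    E-sum = sumBelow-prefixDifferences k E E-stable (λ l → ⌈/N⌉-mono (m≤m+n (Y l) (get y l)))
                                        (n≤0⇒n≡0 (⌈/N⌉-least {t = 0} z≤n))
    e≤y : ∀ l → get e l ≤ get y l
    e≤y l = subst (_≤ get y l) (sym (get-prefixDifferences k E E-stable l))
                  (m≤n+o⇒m∸n≤o (E (suc l)) (E l) (⌈/N⌉-+ (Y l) (get y l)))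
    e-point : LatticePoint 1 d k e
    e-point = record
      { vanishes = λ l k≤l → get-applyUpTo-≥ k _ k≤l
      ; total    = trans (E-sum k) (trans E-total (sym (*-identityˡ d)))
      ; prefix   = λ t → subst₂ _≤_ (sym (E-sum t)) (sym (*-identityˡ t)) (⌈/N⌉-least (prefix p t))
      }

    z = subMono y e
    Z-sum : ∀ t → sumBelow t (get z) ≡ Y t ∸ E t
    Z-sum t = trans (sumBelow-cong t (λ l _ → get-subMono y e l))
                    (trans (sumBelow-∸ t (get y) (get e) e≤y) (cong (Y t ∸_) (E-sum t)))
    z-point : LatticePoint n d k z
    z-point = record
      { vanishes = λ l k≤l → trans (get-subMono y e l) (trans (cong (_∸ get e l) (vanishes p l k≤l)) (0∸n≡0 (get e l)))
      ; total    = trans (Z-sum k) (trans (cong₂ _∸_ (total p) E-total) (m+n∸m≡n d (n * d)))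
      ; prefix   = λ t → subst (_≤ n * t) (sym (Z-sum t)) (∸⌈/N⌉ (prefix p t))
      }

    y≋e+z : y ≋ addMono e z
    y≋e+z = ≋-sym (subst (_≋ y) (addMono-comm z e) (subMono-addMono y e e≤y))

  LatticePoint-π : ∀ {N d k x y} → LatticePoint 1 (N * d) (N * k) x → πN[ N ] x ≡ y → LatticePoint N d k y
  LatticePoint-π {N} {d} {k} {x} {y} p πx≡y = record
    { vanishes = λ l k≤l → trans (sym (πx≡y l)) (sumBelow-zero N (λ r _ → vanishes p (l * N + r)
                   (≤-trans (≤-reflexive (*-comm N k)) (≤-trans (*-monoˡ-≤ N k≤l) (m≤m+n (l * N) r)))))
    ; total    = trans (blocks k) (trans (cong (λ s → sumBelow s (get x)) (*-comm k N))
                                         (trans (total p) (*-identityˡ (N * d))))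
    ; prefix   = λ t → subst₂ _≤_ (sym (blocks t)) (trans (*-identityˡ (t * N)) (*-comm t N)) (prefix p (t * N))
    }
    where
    blocks : ∀ t → sumBelow t (get y) ≡ sumBelow (t * N) (get x)
    blocks = sumBelow-blocks N (get x) (get y) πx≡y

  -- Each entry of y becomes a block of length n + 1 ending with that entry; putting it last keeps prefix sums small.
  spread : ℕ → Mono → Mono
  spread n []      = []
  spread n (a ∷ y) = replicate n 0 ++ (a ∷ spread n y)

  private
    get-replicate-< : ∀ {n r} zs → r < n → get (replicate n 0 ++ zs) r ≡ 0
    get-replicate-< {suc n} {zero}  zs _         = refl
    get-replicate-< {suc n} {suc r} zs (s≤s r<n) = get-replicate-< zs r<n

    get-replicate-+ : ∀ n zs i → get (replicate n 0 ++ zs) (n + i) ≡ get zs i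
    get-replicate-+ zero    zs i = refl
    get-replicate-+ (suc n) zs i = get-replicate-+ n zs i

    next-block : ∀ n q r → suc q * suc n + r ≡ n + suc (q * suc n + r)
    next-block = solve-∀

  get-spread-end : ∀ n y q → get (spread n y) (q * suc n + n) ≡ get y q
  get-spread-end n []      q       = refl
  get-spread-end n (a ∷ y) zero    = trans (cong (get (spread n (a ∷ y))) (sym (+-identityʳ n)))
                                           (get-replicate-+ n (a ∷ spread n y) 0)
  get-spread-end n (a ∷ y) (suc q) = trans (cong (get (spread n (a ∷ y))) (next-block n q n))
    (trans (get-replicate-+ n (a ∷ spread n y) _) (get-spread-end n y q))

  get-spread-inner : ∀ n y q {r} → r < n → get (spread n y) (q * suc n + r) ≡ 0
  get-spread-inner n []      q       r<n = refl
  get-spread-inner n (a ∷ y) zero    r<n = get-replicate-< (a ∷ spread n y) r<n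
  get-spread-inner n (a ∷ y) (suc q) {r} r<n = trans (cong (get (spread n (a ∷ y))) (next-block n q r))
    (trans (get-replicate-+ n (a ∷ spread n y) _) (get-spread-inner n y q r<n))

  sumBelow-spread-inner : ∀ n y q {s} → s ≤ n → sumBelow s (λ r → get (spread n y) (q * suc n + r)) ≡ 0
  sumBelow-spread-inner n y q s≤n = sumBelow-zero _ (λ r r<s → get-spread-inner n y q (<-≤-trans r<s s≤n))

  π-spread : ∀ n y → πN[ suc n ] spread n y ≡ y
  π-spread n y q = trans (cong (_+ get (spread n y) (q * suc n + n)) (sumBelow-spread-inner n y q ≤-refl))
                         (get-spread-end n y q)

  LatticePoint-spread : ∀ n {d k y} → LatticePoint (suc n) d k y →
                        LatticePoint 1 (suc n * d) (suc n * k) (spread n y)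
  LatticePoint-spread n {d} {k} {y} p = record
    { vanishes = vanishes′
    ; total    = trans (cong (λ s → sumBelow s (get x)) (*-comm N k))
                       (trans (sym (blocks k)) (trans (total p) (sym (*-identityˡ (N * d)))))
    ; prefix   = prefix′
    }
    where
    N = suc n
    x = spread n y
    blocks : ∀ t → sumBelow t (get y) ≡ sumBelow (t * N) (get x)
    blocks = sumBelow-blocks N (get x) (get y) (π-spread n y)
    index : ∀ l → l ≡ l / N * N + l % N
    index l = trans (m≡m%n+[m/n]*n l N) (+-comm (l % N) _)
    vanishes′ : ∀ l → N * k ≤ l → get x l ≡ 0
    vanishes′ l Nk≤l with l / N | l % N | index l | m%n<n l N
    ... | q | r | refl | r<N with m≤n⇒m<n∨m≡n (≤-pred r<N)
    ...   | inj₁ r<n  = get-spread-inner n y q r<n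
    ...   | inj₂ refl = trans (get-spread-end n y q) (vanishes p q k≤q)
      where
      k≤q : k ≤ q
      k≤q = ≤-pred (*-cancelˡ-< N k (suc q) (begin-strict
        N * k            ≤⟨ Nk≤l ⟩
        q * N + n        <⟨ +-monoʳ-< (q * N) ≤-refl ⟩
        q * N + N        ≡⟨ +-comm (q * N) N ⟩
        suc q * N        ≡⟨ *-comm (suc q) N ⟩
        N * suc q        ∎))
        where open ≤-Reasoning
    prefix′ : ∀ t → sumBelow t (get x) ≤ 1 * t
    prefix′ t with t / N | t % N | index t | m%n<n t N
    ... | q | r | refl | r<N = begin
      sumBelow (q * N + r) (get x)                                        ≡⟨ sumBelow-+-split (get x) (q * N) r ⟩
      sumBelow (q * N) (get x) + sumBelow r (λ s → get x (q * N + s))     ≡⟨ cong₂ _+_ (sym (blocks q))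
                                                                               (sumBelow-spread-inner n y q (≤-pred r<N)) ⟩
      sumBelow q (get y) + 0                                              ≡⟨ +-identityʳ _ ⟩
      sumBelow q (get y)                                                  ≤⟨ prefix p q ⟩
      N * q                                                               ≡⟨ *-comm N q ⟩
      q * N                                                               ≤⟨ m≤m+n (q * N) r ⟩
      q * N + r                                                           ≡⟨ *-identityˡ _ ⟨
      1 * (q * N + r)                                                     ∎
      where open ≤-Reasoning

open LatticePoints

module Supports where

  open Monomials
  open PrefixSums
  open LatticePoints
  open StructureConstants
  open import Data.Empty using (⊥-elim)
  open import Data.List using ([]; _++_; map; cartesianProductWith)
  open import Data.List.Membership.Propositional using () renaming (_∈_ to _∈ℕ_)
  import Data.List.Membership.Propositional.Properties as ∈ℕ
  open import Data.List.Membership.Setoid ≋-setoid using (_∈_)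
  import Data.List.Membership.Setoid.Properties as Membership
  open import Data.List.Relation.Unary.Any using (here; there)
  open import Data.Nat using (ℕ; zero; suc; _+_; _∸_; _≤_; _<_; z≤n; s≤s; _≟_; _≤?_)
  open import Data.Nat.Properties
  open import Data.Product using (∃; _×_; _,_; proj₁; proj₂)
  open import Data.Sum using (inj₁; inj₂)
  open import Function using (_∘_)
  open import Function.Bundles using (_⇔_; mk⇔; Equivalence)
  import Function.Properties.Equivalence as ⇔
  open import Relation.Binary.PropositionalEquality
  open import Relation.Nullary using (yes; no; ¬_)
  open import Relation.Nullary.Decidable using (_×-dec_)

  -- For m ≤ j, the exponent vectors of C^k_{m,j} (∈-C-monomials⇔) and, for N > 0, of its N-th power.
  record Admissible (N m j k : ℕ) (y : Mono) : Set where
    field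
      lower : j ≤ k
      upper : k ≤ j + m
      point : LatticePoint N (m + j ∸ k) k y

  open Admissible public

  Admissible-resp-≋ : ∀ {N m j k y z} → y ≋ z → Admissible N m j k y → Admissible N m j k z
  Admissible-resp-≋ y≋z a =
    record { lower = lower a ; upper = upper a ; point = LatticePoint-resp-≋ y≋z (point a) }

  -- Multiplying by u - b_{m+1} turns the σ_p-coefficient into a σ_{p+1}-coefficient
  -- (admissible-extend) and multiplies the σ_{p+1}-coefficient by β_{l+1} with m ≤ l ≤ p (admissible-addUnit);
  -- admissible-shrink and admissible-removeUnit undo these two moves.

  admissible-extend : ∀ {m j p e} → Admissible 1 m j p e → Admissible 1 (suc m) j (suc p) e
  admissible-extend {m} {j} a = record
    { lower = m≤n⇒m≤1+n (lower a)
    ; upper = ≤-trans (s≤s (upper a)) (≤-reflexive (sym (+-suc j m)))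
    ; point = LatticePoint-extend (point a)
    }

  admissible-shrink : ∀ {m j p e} → Admissible 1 (suc m) j (suc p) e → j ≤ p → get e p ≡ 0 →
                      Admissible 1 m j p e
  admissible-shrink {m} {j} {p} a j≤p eₚ≡0 = record
    { lower = j≤p
    ; upper = ≤-pred (subst (suc p ≤_) (+-suc j m) (upper a))
    ; point = LatticePoint-shrink (point a) eₚ≡0
    }

  private
    ∸-suc : ∀ {m n} → m < n → suc (n ∸ suc m) ≡ n ∸ m
    ∸-suc m<n = sym (+-∸-assoc 1 m<n)

  admissible-addUnit : ∀ {m j p L l} → Admissible 1 m j (suc p) L → m ≤ l → l ≤ p →
                       Admissible 1 (suc m) j (suc p) (addMono L (unitMono l))
  admissible-addUnit {m} {j} {p} {L} {l} a m≤l l≤p = record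
    { lower = lower a
    ; upper = ≤-trans (upper a) (+-monoʳ-≤ j (n≤1+n m))
    ; point = subst (λ d → LatticePoint 1 d (suc p) (addMono L (unitMono l)))
                    (∸-suc (subst (suc p ≤_) (+-comm j m) (upper a)))
                    (LatticePoint-addUnit (point a) d≤l (s≤s l≤p))
    }
    where
    d≤l : m + j ∸ suc p ≤ l
    d≤l = ≤-trans (∸-monoʳ-≤ (m + j) (lower a)) (≤-trans (≤-reflexive (m+n∸n≡m m j)) m≤l)

  admissible-removeUnit : ∀ {m j p e l} → Admissible 1 (suc m) j (suc p) e → l ≤ p → 0 < get e l →
                          Admissible 1 m j (suc p) (subMono e (unitMono l))
  admissible-removeUnit {m} {j} {p} {e} {l} a l≤p eₗ>0 = record
    { lower = lower a
    ; upper = sp≤j+m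
    ; point = LatticePoint-removeUnit (subst (λ d → LatticePoint 1 d (suc p) e) (sym (∸-suc sp≤m+j)) (point a))
                                      eₗ>0 (s≤s l≤p)
    }
    where
    -- if suc p = j + suc m then e has total 0 and cannot have a positive entry
    sp≤j+m : suc p ≤ j + m
    sp≤j+m with suc p ≤? j + m
    ... | yes sp≤j+m = sp≤j+m
    ... | no  sp≰j+m = ⊥-elim (<⇒≢ eₗ>0 (sym (get-≡ (LatticePoint-null (point a) (trans (*-identityˡ _) d≡0)) l)))
      where
      p≡j+m : p ≡ j + m
      p≡j+m = ≤-antisym (≤-pred (subst (suc p ≤_) (+-suc j m) (upper a))) (≤-pred (≰⇒> sp≰j+m))
      d≡0 : m + j ∸ p ≡ 0
      d≡0 = trans (cong₂ _∸_ (+-comm m j) p≡j+m) (n∸n≡0 (j + m))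
    sp≤m+j : suc p ≤ m + j
    sp≤m+j = subst (suc p ≤_) (+-comm j m) sp≤j+m

  -- If j ≤ p then e_p is the positive entry; otherwise j = p + 1, and the total m + 1 exceeds Σ_{l<m} e_l ≤ m.
  admissible-positive : ∀ {m j p e} → suc m ≤ j → Admissible 1 (suc m) j (suc p) e →
                        ¬ (j ≤ p × get e p ≡ 0) →
                        ∃ λ l → m ≤ l × l ≤ p × 0 < get e l
  admissible-positive {m} {j} {p} {e} m<j a ¬shrinkable with j ≤? p
  ... | yes j≤p = p , ≤-trans (<⇒≤ m<j) j≤p , ≤-refl , n≢0⇒n>0 (λ eₚ≡0 → ¬shrinkable (j≤p , eₚ≡0))
  ... | no  j≰p with sumBelow-<⇒positive (get e) {m} {suc p} (begin-strict
          sumBelow m (get e)          ≤⟨ prefix₁ (point a) m ⟩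
          m                           <⟨ n<1+n m ⟩
          suc m                       ≡⟨ m+n∸n≡m (suc m) p ⟨
          suc m + p ∸ p               ≡⟨ cong (_∸ p) (+-suc m p) ⟨
          m + suc p ∸ p               ≡⟨ cong (λ j → m + j ∸ p) j≡sp ⟨
          m + j ∸ p                   ≡⟨ total₁ (point a) ⟨
          sumBelow (suc p) (get e)    ∎)
    where
    open ≤-Reasoning
    j≡sp : j ≡ suc p
    j≡sp = ≤-antisym (lower a) (≰⇒> j≰p)
  ...   | l , m≤l , l<sp , eₗ>0 = l , m≤l , ≤-pred l<sp , eₗ>0

  ∈-units⇔ : ∀ {m n b} → m ≤ n →
             b ∈ map unitMono (interval m (n ∸ m)) ⇔ ∃ λ l → m ≤ l × l < n × b ≋ unitMono l
  ∈-units⇔ {m} {n} {b} m≤n = mk⇔ to′ from′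
    where
    to′ : b ∈ map unitMono (interval m (n ∸ m)) → ∃ λ l → m ≤ l × l < n × b ≋ unitMono l
    to′ b∈ with Membership.∈-map⁻ (setoid ℕ) ≋-setoid b∈
    ... | l , l∈ , b≋δ with ∈ℕ.∈-map⁻ (m +_) l∈
    ...   | r , r∈ , refl =
      m + r , m≤m+n m r , subst (m + r <_) (m+[n∸m]≡n m≤n) (+-monoʳ-< m (∈ℕ.∈-upTo⁻ r∈)) , b≋δ
    from′ : (∃ λ l → m ≤ l × l < n × b ≋ unitMono l) → b ∈ map unitMono (interval m (n ∸ m))
    from′ (l , m≤l , l<n , b≋δ) =
      Membership.∈-resp-≈ ≋-setoid (≋-sym b≋δ) (Membership.∈-map⁺ (setoid ℕ) ≋-setoid (λ { refl → ≋-refl }) l∈)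
      where
      l∈ : l ∈ℕ interval m (n ∸ m)
      l∈ = subst (_∈ℕ interval m (n ∸ m)) (m+[n∸m]≡n m≤l) (∈ℕ.∈-map⁺ (m +_) (∈ℕ.∈-upTo⁺ (∸-monoˡ-< l<n m≤l)))

  admissible-origin⇔ : ∀ {j p e} → Admissible 1 0 j p e ⇔ (p ≡ j × e ≋ [])
  admissible-origin⇔ {j} {p} {e} = mk⇔ to′ from′
    where
    to′ : Admissible 1 0 j p e → p ≡ j × e ≋ []
    to′ a = p≡j , LatticePoint-null (point a) (trans (*-identityˡ _) (trans (cong (j ∸_) p≡j) (n∸n≡0 j)))
      where
      p≡j : p ≡ j
      p≡j = ≤-antisym (subst (p ≤_) (+-identityʳ j) (upper a)) (lower a)
    from′ : p ≡ j × e ≋ [] → Admissible 1 0 j p e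
    from′ (refl , e≋[]) = record
      { lower = ≤-refl
      ; upper = m≤m+n p 0
      ; point = LatticePoint-[] e≋[] (trans (*-identityˡ (p ∸ p)) (n∸n≡0 p))
      }

  ∈-C-monomials⇔ : ∀ {j m} → m ≤ j → ∀ p {e} → e ∈ C-monomials j m p ⇔ Admissible 1 m j p e
  ∈-C-monomials⇔ {j} {zero} _ p with p ≟ j
  ... | yes refl =
    ⇔.trans (mk⇔ (λ { (here e≋[]) → refl , e≋[] ; (there ()) }) (here ∘ proj₂)) (⇔.sym admissible-origin⇔)
  ... | no  p≢j  = mk⇔ (λ ()) (λ a → ⊥-elim (p≢j (proj₁ (Equivalence.to admissible-origin⇔ a))))
  ∈-C-monomials⇔ {j} {suc m} m<j zero    =
    mk⇔ (λ ()) (λ a → ⊥-elim (<⇒≱ (<-≤-trans (s≤s z≤n) m<j) (lower a)))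
  ∈-C-monomials⇔ {j} {suc m} m<j (suc p) {e} = mk⇔ to from
    where
    A = C-monomials j m
    I = map unitMono (interval m (suc p ∸ m))
    IH = ∈-C-monomials⇔ (<⇒≤ m<j)
    to : e ∈ A p ++ cartesianProductWith addMono (A (suc p)) I → Admissible 1 (suc m) j (suc p) e
    to e∈ with Membership.∈-++⁻ ≋-setoid (A p) e∈
    ... | inj₁ e∈Aₚ = admissible-extend (Equivalence.to (IH p) e∈Aₚ)
    ... | inj₂ e∈L×I
      with Membership.∈-cartesianProductWith⁻ ≋-setoid ≋-setoid ≋-setoid addMono (A (suc p)) I e∈L×I
    ...   | L , b , L∈ , b∈ , e≋L+b with Equivalence.to (IH (suc p)) L∈
    ...     | aL with Equivalence.to (∈-units⇔ (≤-trans (<⇒≤ m<j) (lower aL))) b∈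
    ...       | l , m≤l , l<sp , b≋δ =
      Admissible-resp-≋ (≋-sym (≋-trans e≋L+b (addMono-cong (≋-refl {L}) b≋δ)))
                        (admissible-addUnit aL m≤l (≤-pred l<sp))
    from : Admissible 1 (suc m) j (suc p) e → e ∈ A p ++ cartesianProductWith addMono (A (suc p)) I
    from a with (j ≤? p) ×-dec (get e p ≟ 0)
    ... | yes (j≤p , eₚ≡0) =
      Membership.∈-++⁺ˡ ≋-setoid (Equivalence.from (IH p) (admissible-shrink a j≤p eₚ≡0))
    ... | no  ¬shrinkable with admissible-positive m<j a ¬shrinkable
    ...   | l , m≤l , l≤p , eₗ>0 = Membership.∈-++⁺ʳ ≋-setoid (A p)
      (Membership.∈-resp-≈ ≋-setoid (subMono-addMono e (unitMono l) (unitMono≤ {e} eₗ>0))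
        (Membership.∈-cartesianProductWith⁺ ≋-setoid ≋-setoid ≋-setoid addMono-cong
          (Equivalence.from (IH (suc p)) (admissible-removeUnit a l≤p eₗ>0))
          (Equivalence.from (∈-units⇔ (≤-trans m≤l (m≤n⇒m≤1+n l≤p))) (l , m≤l , s≤s l≤p , ≋-refl))))

open Supports

module Correspondence where

  open Monomials
  open PolynomialRing
  open StructureConstants
  open LatticePoints
  open Supports
  open import Data.Bool using (T; true; false; if_then_else_)
  open import Data.Empty using (⊥-elim)
  open import Data.Integer as ℤ using (1ℤ; +_)
  open import Data.Integer.Properties using (+-injective)
  open import Data.List using (List; []; _∷_; cartesianProductWith)
  open import Data.List.Membership.Setoid ≋-setoid using (_∈_)
  import Data.List.Membership.Setoid.Properties as Membership
  open import Data.List.Relation.Unary.Any using (here; there)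
  open import Data.Nat using (ℕ; zero; suc; _+_; _*_; _∸_; _≤_)
  open import Data.Nat.Properties
  open import Data.Product using (Σ; ∃₂; _×_; _,_)
  open import Function.Bundles using (_⇔_; mk⇔; Equivalence)
  import Function.Properties.Equivalence as ⇔
  open import Level using (0ℓ)
  open import Relation.Binary.PropositionalEquality
  import Relation.Binary.Reasoning.Setoid as SetoidReasoning
  open Equivalence using (to; from)

  multiplicity : Mono → List Mono → ℕ
  multiplicity e []       = 0
  multiplicity e (L ∷ Ls) = if eqMono L e then suc (multiplicity e Ls) else multiplicity e Ls

  coeff-toPoly : ∀ Ls e → coeff (toPoly Ls) e ≡ + multiplicity e Ls
  coeff-toPoly []       e = refl
  coeff-toPoly (L ∷ Ls) e with eqMono L e
  ... | true  = cong (λ c → 1ℤ ℤ.+ c) (coeff-toPoly Ls e)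
  ... | false = coeff-toPoly Ls e

  multiplicity≢0⇔∈ : ∀ {e} Ls → (multiplicity e Ls ≢ 0) ⇔ e ∈ Ls
  multiplicity≢0⇔∈ {e} Ls = mk⇔ (≢0⇒∈ Ls) (∈⇒≢0 Ls)
    where
    ≢0⇒∈ : ∀ Ls → multiplicity e Ls ≢ 0 → e ∈ Ls
    ≢0⇒∈ []       m≢0 = ⊥-elim (m≢0 refl)
    ≢0⇒∈ (L ∷ Ls) m≢0 with eqMono L e in L=e
    ... | true  = here (≋-sym (eqMono⇒≋ L e (subst T (sym L=e) _)))
    ... | false = there (≢0⇒∈ Ls m≢0)
    ∈⇒≢0 : ∀ Ls → e ∈ Ls → multiplicity e Ls ≢ 0
    ∈⇒≢0 (L ∷ Ls) e∈ with eqMono L e in L=e | e∈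
    ... | true  | _         = λ ()
    ... | false | here e≋L  = ⊥-elim (subst T L=e (≋⇒eqMono L e (≋-sym e≋L)))
    ... | false | there e∈′ = ∈⇒≢0 Ls e∈′

  ∈Supp-toPoly⇔ : ∀ {e} Ls → e ∈Supp toPoly Ls ⇔ e ∈ Ls
  ∈Supp-toPoly⇔ {e} Ls = ⇔.trans (mk⇔ to′ from′) (multiplicity≢0⇔∈ Ls)
    where
    to′ : e ∈Supp toPoly Ls → multiplicity e Ls ≢ 0
    to′ e∈ m≡0 = e∈ (trans (coeff-toPoly Ls e) (cong +_ m≡0))
    from′ : multiplicity e Ls ≢ 0 → e ∈Supp toPoly Ls
    from′ m≢0 c≡0 = m≢0 (+-injective (trans (sym (coeff-toPoly Ls e)) c≡0))

  ∈Supp-cong : ∀ {e p q} → p ≈ q → e ∈Supp p ⇔ e ∈Supp q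
  ∈Supp-cong {e} p≈q = mk⇔ (λ e∈p c≡0 → e∈p (trans (coeff-≡ p≈q e) c≡0))
                           (λ e∈q c≡0 → e∈q (trans (sym (coeff-≡ p≈q e)) c≡0))

  ∈Supp-positive : ∀ {e P} Ls → P ≈ toPoly Ls → e ∈Supp P ⇔ e ∈ Ls
  ∈Supp-positive Ls P≈ = ⇔.trans (∈Supp-cong P≈) (∈Supp-toPoly⇔ Ls)

  powerMonomials : List Mono → ℕ → List Mono
  powerMonomials Ls zero    = [] ∷ []
  powerMonomials Ls (suc N) = cartesianProductWith addMono Ls (powerMonomials Ls N)

  ppow-toPoly : ∀ Ls N → ppow (toPoly Ls) N ≈ toPoly (powerMonomials Ls N)
  ppow-toPoly Ls zero    = ≈-refl
  ppow-toPoly Ls (suc N) =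
    ≈-trans (pmul-congˡ (toPoly Ls) (ppow-toPoly Ls N))
            (≈-reflexive (sym (toPoly-cartesianProductWith Ls (powerMonomials Ls N))))

  ppow-cong : ∀ {p q} N → p ≈ q → ppow p N ≈ ppow q N
  ppow-cong zero    p≈q = ≈-refl
  ppow-cong (suc N) p≈q = pmul-cong p≈q (ppow-cong N p≈q)

  Sum : ℕ → (Mono → Set) → Mono → Set
  Sum zero    P y = y ≋ []
  Sum (suc N) P y = ∃₂ λ e z → P e × Sum N P z × y ≋ addMono e z

  Sum-map : ∀ {P Q : Mono → Set} → (∀ {e} → P e → Q e) → ∀ N {y} → Sum N P y → Sum N Q y
  Sum-map P⇒Q zero    y≋[]                  = y≋[]
  Sum-map P⇒Q (suc N) (e , z , Pe , Pz , y≋) = e , z , P⇒Q Pe , Sum-map P⇒Q N Pz , y≋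

  Sum-cong : ∀ {P Q : Mono → Set} → (∀ {e} → P e ⇔ Q e) → ∀ N {y} → Sum N P y ⇔ Sum N Q y
  Sum-cong P⇔Q N = mk⇔ (Sum-map (to P⇔Q) N) (Sum-map (from P⇔Q) N)

  ∈-powerMonomials⇔ : ∀ Ls N {y} → y ∈ powerMonomials Ls N ⇔ Sum N (_∈ Ls) y
  ∈-powerMonomials⇔ Ls zero    = mk⇔ (λ { (here y≋[]) → y≋[] ; (there ()) }) here
  ∈-powerMonomials⇔ Ls (suc N) {y} = mk⇔ to′ from′
    where
    IH = ∈-powerMonomials⇔ Ls N
    to′ : y ∈ powerMonomials Ls (suc N) → Sum (suc N) (_∈ Ls) y
    to′ y∈
      with Membership.∈-cartesianProductWith⁻ ≋-setoid ≋-setoid ≋-setoid addMono Ls (powerMonomials Ls N) y∈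
    ... | e , z , e∈ , z∈ , y≋ = e , z , e∈ , to IH z∈ , y≋
    from′ : Sum (suc N) (_∈ Ls) y → y ∈ powerMonomials Ls (suc N)
    from′ (e , z , e∈ , sz , y≋) = Membership.∈-resp-≈ ≋-setoid (≋-sym y≋)
      (Membership.∈-cartesianProductWith⁺ ≋-setoid ≋-setoid ≋-setoid addMono-cong e∈ (from IH sz))

  ∈Supp-ppow-positive : ∀ {y Q} Ls → Q ≈ toPoly Ls → ∀ N → y ∈Supp ppow Q N ⇔ Sum N (_∈ Ls) y
  ∈Supp-ppow-positive Ls Q≈ N =
    ⇔.trans (∈Supp-positive (powerMonomials Ls N) (≈-trans (ppow-cong N Q≈) (ppow-toPoly Ls N)))
            (∈-powerMonomials⇔ Ls N)

  Sum⇔LatticePoint : ∀ N {d k y} → Sum N (LatticePoint 1 d k) y ⇔ LatticePoint N d k y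
  Sum⇔LatticePoint zero    = mk⇔ (λ y≋[] → LatticePoint-[] y≋[] refl) (λ p → LatticePoint-null p refl)
  Sum⇔LatticePoint (suc N) = mk⇔
    (λ (e , z , pe , sz , y≋) → LatticePoint-resp-≋ (≋-sym y≋) (LatticePoint-+ pe (to (Sum⇔LatticePoint N) sz)))
    (λ p → let e , z , pe , pz , y≋ = LatticePoint-split N p in e , z , pe , from (Sum⇔LatticePoint N) pz , y≋)

  Sum⇔Admissible : ∀ n {m j k y} → Sum (suc n) (Admissible 1 m j k) y ⇔ Admissible (suc n) m j k y
  Sum⇔Admissible n {m} {j} {k} = mk⇔
    (λ { s@(_ , _ , ae , _) → record { lower = lower ae ; upper = upper ae
                                     ; point = to (Sum⇔LatticePoint (suc n)) (Sum-map point (suc n) s) } })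
    (λ a → Sum-map (λ p → record { lower = lower a ; upper = upper a ; point = p }) (suc n)
                   (from (Sum⇔LatticePoint (suc n)) (point a)))

  π⇔Admissible : ∀ n {m j k y} → let N = suc n in
                 (Σ Mono λ x → Admissible 1 (N * m) (N * j) (N * k) x × πN[ N ] x ≡ y) ⇔ Admissible N m j k y
  π⇔Admissible n {m} {j} {k} {y} = mk⇔
    (λ { (x , a , πx≡y) → record
         { lower = *-cancelˡ-≤ N (lower a)
         ; upper = *-cancelˡ-≤ N (subst (N * k ≤_) (sym (*-distribˡ-+ N j m)) (upper a))
         ; point = LatticePoint-π (subst (λ d → LatticePoint 1 d (N * k) x) d≡ (point a)) πx≡y
         } })
    (λ a → spread n y , record
         { lower = *-monoʳ-≤ N (lower a)
         ; upper = subst (N * k ≤_) (*-distribˡ-+ N j m) (*-monoʳ-≤ N (upper a))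
         ; point = subst (λ d → LatticePoint 1 d (N * k) (spread n y)) (sym d≡) (LatticePoint-spread n (point a))
         } , π-spread n y)
    where
    N = suc n
    d≡ : N * m + N * j ∸ N * k ≡ N * (m + j ∸ k)
    d≡ = sym (trans (*-distribˡ-∸ N (m + j) k) (cong (_∸ N * k) (*-distribˡ-+ N m j)))

  π-Supp⇔Supp-ppow : ∀ n {m J k P Q} → m ≤ J →
              P ≈ toPoly (C-monomials (suc n * J) (suc n * m) (suc n * k)) → Q ≈ toPoly (C-monomials J m k) →
              ∀ y → (Σ Mono λ x → (x ∈Supp P) × (πN[ suc n ] x ≡ y)) ⇔ (y ∈Supp ppow Q (suc n))
  π-Supp⇔Supp-ppow n {m} {J} {k} {P} {Q} m≤J P≈ Q≈ y = begin
    (Σ Mono λ x → (x ∈Supp P) × (πN[ N ] x ≡ y))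
      ≈⟨ mk⇔ (λ (x , x∈ , π) → x , to (x∈SuppP⇔ x) x∈ , π) (λ (x , a , π) → x , from (x∈SuppP⇔ x) a , π) ⟩
    (Σ Mono λ x → Admissible 1 (N * m) (N * J) (N * k) x × πN[ N ] x ≡ y)
      ≈⟨ π⇔Admissible n ⟩
    Admissible N m J k y
      ≈⟨ Sum⇔Admissible n ⟨
    Sum N (Admissible 1 m J k) y
      ≈⟨ Sum-cong (⇔.sym (∈-C-monomials⇔ m≤J k)) N ⟩
    Sum N (_∈ C-monomials J m k) y
      ≈⟨ ∈Supp-ppow-positive (C-monomials J m k) Q≈ N ⟨
    y ∈Supp ppow Q N
      ∎
    where
    open SetoidReasoning (⇔.⇔-setoid 0ℓ)
    N = suc n
    x∈SuppP⇔ : ∀ x → x ∈Supp P ⇔ Admissible 1 (N * m) (N * J) (N * k) x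
    x∈SuppP⇔ x = ⇔.trans (∈Supp-positive _ P≈) (∈-C-monomials⇔ (*-monoʳ-≤ N m≤J) (N * k))

open Correspondence

open import Data.Nat using (ℕ; suc; _*_; _≤_)
open import Data.Nat.Properties using (≤-total; *-monoʳ-≤)
open import Data.Product using (Σ; _×_)
open import Data.Sum using (inj₁; inj₂)
open import Function.Bundles using (_⇔_)

theorem3p2 : (i j k N : ℕ) → 1 ≤ N → (y : Mono) →
    (Σ Mono (λ x → (x ∈Supp C (N * k) (N * i) (N * j)) × (πN[ N ] x ≡ y))) ⇔ (y ∈Supp ppow (C k i j) N)
theorem3p2 i j k (suc n) _ y with ≤-total i j
... | inj₁ i≤j = π-Supp⇔Supp-ppow n i≤j (C-positive (*-monoʳ-≤ (suc n) i≤j) (suc n * k)) (C-positive i≤j k) y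
... | inj₂ j≤i = π-Supp⇔Supp-ppow n j≤i (C-positive′ (*-monoʳ-≤ (suc n) j≤i) (suc n * k)) (C-positive′ j≤i k) y
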